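{- Let $n\ge1$ and let $T,T'$ be wiggly pseudotriangulations with $T\setminus\{\alpha\}=T'\setminus\{\alpha'\}$ for wiggly arcs $\alpha=(i,j,A,B)\in T$ and $\alpha'=(i',j',A',B')\in T'$, $\alpha\ne\alpha'$. Let $\beta,\beta'$ be defined as follows, with the names of $(\alpha,T)$ and $(\alpha',T')$ exchanged if necessary so that, in the non pointed case, $j=i'$, and in the crossing case, $\alpha$ crosses $\alpha'$ from north-west to south-east: (1) if $\alpha,\alpha'$ are non pointed: $\beta=(i,j',A\cup A',B\cup B'\cup\{j\})$, $\beta'=(i,j',A\cup A'\cup\{j\},B\cup B')$; (2) if $\alpha,\alpha'$ are crossing: $\beta=(i',j,I\setminus(B\cup B'),I\cap(B\cup B'))$ with $I=\{i'+1,\dots,j-1\}$, and $\beta'=(i,j',J\cap(A\cup A'),J\setminus(A\cup A'))$ with $J=\{i+1,\dots,j'-1\}$. Then $\{\beta,\beta'\}\subseteq T\cap T'$, and in case (1) $\mathbf{g}(\alpha)+\mathbf{g}(\alpha')=(\mathbf{g}(\beta)+\mathbf{g}(\beta'))/2$, while in case (2) $\mathbf{g}(\alpha)+\mathbf{g}(\alpha')=\mathbf{g}(\beta)+\mathbf{g}(\beta')$.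
   Context: Points $0,\dots,n+1$ on a horizontal line. A wiggly arc is $(i,j,A,B)$ with $0\le i<j\le n+1$ and $A\sqcup B=\{i+1,\dots,j-1\}$ (curve from $i$ to $j$ above $A$, below $B$); external arcs $(0,n+1,[n],\varnothing)$, $(0,n+1,\varnothing,[n])$. Arcs $(i,j,A,B)$, $(i',j',A',B')$ are non pointed if $i=j'$ or $i'=j$; crossing if $(A\cap B')\cup(\{i,j\}\cap B')\cup(A\cap\{i',j'\})\ne\varnothing\ne(A'\cap B)\cup(\{i',j'\}\cap B)\cup(A'\cap\{i,j\})$; compatible if neither. $\alpha$ crosses $\alpha'$ from north-west to south-east if there exist $1\le k<\ell\le n$ with $k\in(A\cap B')\cup(\{i\}\cap B')\cup(A\cap\{i'\})$ and $\ell\in(A'\cap B)\cup(\{j'\}\cap B)\cup(A'\cap\{j\})$. A wiggly pseudotriangulation is an inclusion-maximal set of pairwise compatible arcs containing both external arcs. $\mathbf{g}(\alpha)=\pi(\mathbf{1}_{\alpha^+}-\mathbf{1}_{\alpha^- })$ with $\alpha^+=(\{2i-1,2j\}\setminus\{ -1,2n+2\})\cup\{2a-1,2a:a\in A\}$, $\alpha^-=(\{2i,2j-1\}\setminus\{0,2n+1\})\cup\{2b-1,2b:b\in B\}$, $\pi$ the orthogonal projection of $\mathbb{R}^{2n}$ onto $\{\mathbf{x}:\sum x_k=0\}$. -}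

module Defs where

open import Data.Nat using (ℕ; zero; suc; _+_; _*_; _∸_; _≤_; _<_; _≡ᵇ_; _<ᵇ_)
open import Data.Bool using (Bool; true; false; _∧_; _∨_; not; if_then_else_)
open import Data.List using (List; []; _∷_; map; upTo; length)
open import Data.Maybe using (Maybe; just; nothing)
open import Data.Product using (_×_; ∃-syntax)
open import Data.Sum using (_⊎_)
open import Data.Integer using (+_)
open import Data.Rational using (ℚ; 0ℚ; 1ℚ; _/_) renaming (_+_ to _+ℚ_; _-_ to _-ℚ_; _*_ to _*ℚ_)
open import Relation.Binary.PropositionalEquality using (_≡_; _≢_)

-- An arc (i , j , A , B) is encoded canonically as  arc i j s  where
-- s is the list of sides of the points i+1, ..., j-1 (in this order):
-- true = the point lies in A (curve passes above it),
-- false = the point lies in B (curve passes below it).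
-- Thus A ⊔ B = {i+1,...,j-1} holds by construction.

record Arc : Set where
  constructor arc
  field
    i : ℕ
    j : ℕ
    side : List Bool
open Arc public

IsArc : ℕ → Arc → Set
IsArc n α = (i α < j α) × (j α ≤ suc n) × (length (side α) ≡ j α ∸ i α ∸ 1)

nth : List Bool → ℕ → Maybe Bool
nth [] _ = nothing
nth (b ∷ bs) zero = just b
nth (b ∷ bs) (suc k) = nth bs k

sideOf : Arc → ℕ → Maybe Bool
sideOf α k = if i α <ᵇ k then nth (side α) (k ∸ suc (i α)) else nothing

isA : Arc → ℕ → Bool
isA α k with sideOf α k
... | just true = true
... | _ = false

isB : Arc → ℕ → Bool
isB α k with sideOf α k
... | just false = true
... | _ = false

_∈A_ : ℕ → Arc → Set
k ∈A α = isA α k ≡ true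

_∈B_ : ℕ → Arc → Set
k ∈B α = isB α k ≡ true

-- the arc (i , j , A , {i+1..j-1} ∖ A) where A is given by its
-- characteristic function f (only its values on {i+1,...,j-1} are used)
mkArc : ℕ → ℕ → (ℕ → Bool) → Arc
mkArc a b f = arc a b (map (λ t → f (suc a + t)) (upTo (b ∸ a ∸ 1)))

extAbove : ℕ → Arc
extAbove n = mkArc 0 (suc n) (λ _ → true)

extBelow : ℕ → Arc
extBelow n = mkArc 0 (suc n) (λ _ → false)

NonPointed : Arc → Arc → Set
NonPointed α α' = (i α ≡ j α') ⊎ (i α' ≡ j α)

CrossSide : Arc → Arc → Set
CrossSide α α' = ∃[ k ]
  ( (k ∈A α × k ∈B α')
  ⊎ (((k ≡ i α) ⊎ (k ≡ j α)) × k ∈B α')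
  ⊎ (k ∈A α × ((k ≡ i α') ⊎ (k ≡ j α'))))

Crossing : Arc → Arc → Set
Crossing α α' = CrossSide α α' × CrossSide α' α

Compatible : Arc → Arc → Set
Compatible α α' = (NonPointed α α' → Data.Empty.⊥) × (Crossing α α' → Data.Empty.⊥)
  where import Data.Empty

CrossesNWSE : ℕ → Arc → Arc → Set
CrossesNWSE n α α' = ∃[ k ] ∃[ ℓ ]
  ( (1 ≤ k) × (k < ℓ) × (ℓ ≤ n)
  × ( (k ∈A α × k ∈B α') ⊎ ((k ≡ i α) × k ∈B α') ⊎ (k ∈A α × (k ≡ i α')) )
  × ( (ℓ ∈A α' × ℓ ∈B α) ⊎ ((ℓ ≡ j α') × ℓ ∈B α) ⊎ (ℓ ∈A α' × (ℓ ≡ j α)) ) )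

ArcSet : Set₁
ArcSet = Arc → Set

record IsWigglyPT (n : ℕ) (T : ArcSet) : Set where
  field
    valid      : ∀ γ → T γ → IsArc n γ
    hasAbove   : T (extAbove n)
    hasBelow   : T (extBelow n)
    pairwise   : ∀ γ δ → T γ → T δ → Compatible γ δ
    maximal    : ∀ γ → IsArc n γ → (∀ δ → (T δ ⊎ δ ≡ γ) → Compatible γ δ) → T γ

-- g-vectors. Vectors of ℝ^{2n} (here with rational entries) are
-- functions ℕ → ℚ, of which only coordinates 1,...,2n are meaningful.

-- indicator of α⁺ = ({2i-1, 2j} ∖ {-1, 2n+2}) ∪ {2a-1, 2a : a ∈ A}
inPlus : ℕ → Arc → ℕ → Bool
inPlus n α c =
  ((c + 1 ≡ᵇ 2 * i α) ∧ not (i α ≡ᵇ 0))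
  ∨ ((c ≡ᵇ 2 * j α) ∧ not (j α ≡ᵇ suc n))
  ∨ isA α ((c + 1) Data.Nat./ 2)
  where import Data.Nat

-- indicator of α⁻ = ({2i, 2j-1} ∖ {0, 2n+1}) ∪ {2b-1, 2b : b ∈ B}
inMinus : ℕ → Arc → ℕ → Bool
inMinus n α c =
  ((c ≡ᵇ 2 * i α) ∧ not (i α ≡ᵇ 0))
  ∨ ((c + 1 ≡ᵇ 2 * j α) ∧ not (j α ≡ᵇ suc n))
  ∨ isB α ((c + 1) Data.Nat./ 2)
  where import Data.Nat

ind : Bool → ℚ
ind true = 1ℚ
ind false = 0ℚ

sumTo : ℕ → (ℕ → ℚ) → ℚ
sumTo zero x = 0ℚ
sumTo (suc m) x = sumTo m x +ℚ x (suc m)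

-- 1 / (2n)  (n ≥ 1 in all uses; the value at n = 0 is irrelevant)
inv2n : ℕ → ℚ
inv2n zero = 0ℚ
inv2n (suc m) = (+ 1) / (2 * suc m)

-- orthogonal projection of ℝ^{2n} onto {x : Σ_k x_k = 0}
proj : ℕ → (ℕ → ℚ) → (ℕ → ℚ)
proj n x c = x c -ℚ (sumTo (2 * n) x *ℚ inv2n n)

g : ℕ → Arc → (ℕ → ℚ)
g n α = proj n (λ c → ind (inPlus n α c) -ℚ ind (inMinus n α c))

_≈[_]_ : (ℕ → ℚ) → ℕ → (ℕ → ℚ) → Set
x ≈[ n ] y = ∀ c → 1 ≤ c → c ≤ 2 * n → x c ≡ y c

_⊕_ : (ℕ → ℚ) → (ℕ → ℚ) → (ℕ → ℚ)
(x ⊕ y) c = x c +ℚ y c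

half : (ℕ → ℚ) → (ℕ → ℚ)
half x c = x c *ℚ ((+ 1) / 2)

β₁ : Arc → Arc → Arc
β₁ α α' = mkArc (i α) (j α') (λ k → isA α k ∨ isA α' k)

β₁' : Arc → Arc → Arc
β₁' α α' = mkArc (i α) (j α') (λ k → isA α k ∨ isA α' k ∨ (k ≡ᵇ j α))

β₂ : Arc → Arc → Arc
β₂ α α' = mkArc (i α') (j α) (λ k → not (isB α k ∨ isB α' k))

β₂' : Arc → Arc → Arc
β₂' α α' = mkArc (i α) (j α') (λ k → isA α k ∨ isA α' k)

{-# OPTIONS --safe #-}
-- An arc γ gives every point x a level: above if x ∈ A, below if x ∈ B, through otherwise;
-- two arcs cross exactly when each is strictly higher than the other somewhere.
-- Since T ∖ {α} = T′ ∖ {α′}, maximality puts into T ∩ T′ every arc that is compatible with α,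
-- with α′, and with every arc compatible with both, and β, β′ are such arcs. In the crossing
-- case this needs that α crosses α′ only once: a crossing back would contain a tight switch
-- (α′ above α, then α above α′, at the same level in between), and cutting α there gives an
-- arc of T ∩ T′ that crosses α′. Reflecting all arcs in the horizontal line reduces β′ to β.
-- Finally 1_{α⁺} − 1_{α⁻} is a term for each endpoint plus the level of α at ⌈c/2⌉. A crossing
-- flip keeps the endpoints and, pointwise, the levels of α and α′; in the non-pointed case the
-- end of α cancels the start of α′, and β, β′ together have twice the levels of α and α′.
module Submission where

open import Defs
open import Algebra.Bundles using (CommutativeMonoid)
open import Data.Bool using (Bool; true; false; _∧_; _∨_; not; T) renaming (_≟_ to _≟ᵇ_)
open import Data.Bool.Properties using (T-∧)
open import Data.Empty using (⊥; ⊥-elim)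
open import Data.Integer using (+_)
open import Data.List using (List; []; _∷_; map; upTo; length; applyUpTo)
open import Data.List.Properties using (length-map; length-upTo; map-applyUpTo; ≡-dec)
open import Data.Maybe using (Maybe; just; nothing)
import Data.Maybe
open import Data.Nat using (ℕ; zero; suc; _+_; _*_; _∸_; _≤_; _<_; _≡ᵇ_; _<ᵇ_; z≤n; s≤s; _≟_; _<?_; _≤?_)
import Data.Nat as ℕ
open import Data.Nat.Divisibility using (divides)
open import Data.Nat.DivMod using (/-congˡ; m*n/n≡m; +-distrib-/-∣ˡ)
open import Data.Nat.Properties
open import Data.Product using (_×_; _,_; proj₁; proj₂; Σ; ∃-syntax)
import Data.Product as Product
open import Data.Rational using (ℚ; 0ℚ; 1ℚ; _/_) renaming (_+_ to _+ℚ_; _-_ to _-ℚ_; _*_ to _*ℚ_; -_ to -ℚ_)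
import Data.Rational.Properties as ℚ
open import Data.Rational.Solver using (module +-*-Solver)
open +-*-Solver using (solve; _:+_; _:-_; _:*_; _:=_; con)
open import Data.Sum using (_⊎_; inj₁; inj₂; [_,_]′)
import Data.Sum as Sum
open import Function using (_∘_)
open import Function.Bundles using (_⇔_; Equivalence)
open import Function.Properties.Equivalence using () renaming (sym to ⇔-sym)
open import Relation.Binary.Definitions using (tri<; tri≈; tri>)
open import Relation.Binary.PropositionalEquality
open import Relation.Nullary using (¬_; Dec; yes; no)
open import Relation.Nullary.Decidable using (dec-true; dec-false)

open import Algebra.Properties.CommutativeSemigroup (CommutativeMonoid.commutativeSemigroup ℚ.+-0-commutativeMonoid)
  using () renaming (interchange to +-interchange)
open ≡-Reasoning

data Level : Set where
  below through above : Level

data _<ˡ_ : Level → Level → Set where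
  below<through : below <ˡ through
  below<above   : below <ˡ above
  through<above : through <ˡ above

<ˡ-irrefl : ∀ {u} → ¬ (u <ˡ u)
<ˡ-irrefl ()

<ˡ-asym : ∀ {u w} → u <ˡ w → ¬ (w <ˡ u)
<ˡ-asym below<through ()
<ˡ-asym below<above ()
<ˡ-asym through<above ()

<ˡ-cast : ∀ {u w u′ w′} → u ≡ u′ → w ≡ w′ → u′ <ˡ w′ → u <ˡ w
<ˡ-cast refl refl o = o

<ˡ-cmp : ∀ u w → u <ˡ w ⊎ u ≡ w ⊎ w <ˡ u
<ˡ-cmp below   below   = inj₂ (inj₁ refl)
<ˡ-cmp below   through = inj₁ below<through
<ˡ-cmp below   above   = inj₁ below<above
<ˡ-cmp through below   = inj₂ (inj₂ below<through)
<ˡ-cmp through through = inj₂ (inj₁ refl)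
<ˡ-cmp through above   = inj₁ through<above
<ˡ-cmp above   below   = inj₂ (inj₂ below<above)
<ˡ-cmp above   through = inj₂ (inj₂ through<above)
<ˡ-cmp above   above   = inj₂ (inj₁ refl)

<ˡ-cotrans : ∀ {u w} v → u <ˡ w → v <ˡ w ⊎ u <ˡ v
<ˡ-cotrans below   below<through = inj₁ below<through
<ˡ-cotrans through below<through = inj₂ below<through
<ˡ-cotrans above   below<through = inj₂ below<above
<ˡ-cotrans below   below<above   = inj₁ below<above
<ˡ-cotrans through below<above   = inj₁ through<above
<ˡ-cotrans above   below<above   = inj₂ below<above
<ˡ-cotrans below   through<above = inj₁ below<above
<ˡ-cotrans through through<above = inj₁ through<above
<ˡ-cotrans above   through<above = inj₂ through<above

below≢through : below ≢ through
below≢through ()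

above≢through : above ≢ through
above≢through ()

≮below : ∀ {u w} → w ≡ below → ¬ (u <ˡ w)
≮below refl ()

above≮ : ∀ {u w} → u ≡ above → ¬ (u <ˡ w)
above≮ refl ()

<through⇒below : ∀ {u w} → w ≡ through → u <ˡ w → u ≡ below
<through⇒below refl below<through = refl

<above⇒through : ∀ {u w} → w ≡ above → u <ˡ w → u ≢ below → u ≡ through
<above⇒through refl below<above u≢below = ⊥-elim (u≢below refl)
<above⇒through refl through<above _ = refl

through<⇒below< : ∀ {w} → through <ˡ w → below <ˡ w
through<⇒below< through<above = below<above

≢through≢below⇒above : ∀ {u} → u ≢ through → u ≢ below → u ≡ above
≢through≢below⇒above {below}   _ u≢below = ⊥-elim (u≢below refl)
≢through≢below⇒above {through} u≢through _ = ⊥-elim (u≢through refl)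
≢through≢below⇒above {above}   _ _ = refl

<ˡ-off-through : ∀ {u w} → u ≢ through → w ≢ through → u <ˡ w → u ≡ below × w ≡ above
<ˡ-off-through _ w≢through below<through = ⊥-elim (w≢through refl)
<ˡ-off-through _ _ below<above = refl , refl
<ˡ-off-through u≢through _ through<above = ⊥-elim (u≢through refl)

negate : Level → Level
negate below   = above
negate through = through
negate above   = below

negate-<ˡ : ∀ {u w} → u <ˡ w → negate w <ˡ negate u
negate-<ˡ below<through = through<above
negate-<ˡ below<above   = below<above
negate-<ˡ through<above = below<through

negate-involutive : ∀ u → negate (negate u) ≡ u
negate-involutive below   = refl
negate-involutive through = refl
negate-involutive above   = refl

negate-<ˡ⁻¹ : ∀ {u w} → negate u <ˡ negate w → w <ˡ u
negate-<ˡ⁻¹ {u} {w} o = <ˡ-cast (sym (negate-involutive w)) (sym (negate-involutive u)) (negate-<ˡ o)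

levelOf : Maybe Bool → Level
levelOf (just true)  = above
levelOf (just false) = below
levelOf nothing      = through

isAbove : Level → Bool
isAbove above = true
isAbove _     = false

isBelow : Level → Bool
isBelow below = true
isBelow _     = false

-- the levels of β₂ and β₂' (which is β₁) at interior points
lower : Level → Level → Level
lower u w = levelOf (just (not (isBelow u ∨ isBelow w)))

upper : Level → Level → Level
upper u w = levelOf (just (isAbove u ∨ isAbove w))

lower-cases : ∀ u w → (lower u w ≡ below × (u ≡ below ⊎ w ≡ below)) ⊎ (lower u w ≡ above × u ≢ below × w ≢ below)
lower-cases below   w       = inj₁ (refl , inj₁ refl)
lower-cases through below   = inj₁ (refl , inj₂ refl)
lower-cases above   below   = inj₁ (refl , inj₂ refl)
lower-cases through through = inj₂ (refl , (λ ()) , (λ ()))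
lower-cases through above   = inj₂ (refl , (λ ()) , (λ ()))
lower-cases above   through = inj₂ (refl , (λ ()) , (λ ()))
lower-cases above   above   = inj₂ (refl , (λ ()) , (λ ()))

negate-upper : ∀ u w → negate (upper u w) ≡ lower (negate w) (negate u)
negate-upper below   below   = refl
negate-upper below   through = refl
negate-upper below   above   = refl
negate-upper through below   = refl
negate-upper through through = refl
negate-upper through above   = refl
negate-upper above   below   = refl
negate-upper above   through = refl
negate-upper above   above   = refl

upper-through : ∀ u → u ≢ through → upper u through ≡ u
upper-through below   _ = refl
upper-through through u≢through = ⊥-elim (u≢through refl)
upper-through above   _ = refl

through-upper : ∀ w → w ≢ through → upper through w ≡ w
through-upper below   _ = refl
through-upper through w≢through = ⊥-elim (w≢through refl)
through-upper above   _ = refl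

lower-through : ∀ u → u ≢ through → lower u through ≡ u
lower-through below   _ = refl
lower-through through u≢through = ⊥-elim (u≢through refl)
lower-through above   _ = refl

through-lower : ∀ w → w ≢ through → lower through w ≡ w
through-lower below   _ = refl
through-lower through w≢through = ⊥-elim (w≢through refl)
through-lower above   _ = refl

lower-upper-swap : ∀ u w → u ≢ through → w ≢ through
                 → (lower u w ≡ u × upper u w ≡ w) ⊎ (lower u w ≡ w × upper u w ≡ u)
lower-upper-swap below below _ _ = inj₁ (refl , refl)
lower-upper-swap below above _ _ = inj₁ (refl , refl)
lower-upper-swap above below _ _ = inj₂ (refl , refl)
lower-upper-swap above above _ _ = inj₁ (refl , refl)
lower-upper-swap through _ u≢through _ = ⊥-elim (u≢through refl)
lower-upper-swap below through _ w≢through = ⊥-elim (w≢through refl)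
lower-upper-swap above through _ w≢through = ⊥-elim (w≢through refl)

level : Arc → ℕ → Level
level γ x = levelOf (sideOf γ x)

isA≡isAbove : ∀ γ x → isA γ x ≡ isAbove (level γ x)
isA≡isAbove γ x with sideOf γ x
... | just true  = refl
... | just false = refl
... | nothing    = refl

isB≡isBelow : ∀ γ x → isB γ x ≡ isBelow (level γ x)
isB≡isBelow γ x with sideOf γ x
... | just true  = refl
... | just false = refl
... | nothing    = refl

isAbove⇒above : ∀ {u} → isAbove u ≡ true → u ≡ above
isAbove⇒above {above} _ = refl

isBelow⇒below : ∀ {u} → isBelow u ≡ true → u ≡ below
isBelow⇒below {below} _ = refl

∈A⇒above : ∀ γ x → x ∈A γ → level γ x ≡ above
∈A⇒above γ x x∈A = isAbove⇒above (trans (sym (isA≡isAbove γ x)) x∈A)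

∈B⇒below : ∀ γ x → x ∈B γ → level γ x ≡ below
∈B⇒below γ x x∈B = isBelow⇒below (trans (sym (isB≡isBelow γ x)) x∈B)

above⇒∈A : ∀ γ x → level γ x ≡ above → x ∈A γ
above⇒∈A γ x e = trans (isA≡isAbove γ x) (cong isAbove e)

below⇒∈B : ∀ γ x → level γ x ≡ below → x ∈B γ
below⇒∈B γ x e = trans (isB≡isBelow γ x) (cong isBelow e)

WellFormed : Arc → Set
WellFormed γ = (i γ < j γ) × (length (side γ) ≡ j γ ∸ i γ ∸ 1)

IsArc⇒WellFormed : ∀ {n} γ → IsArc n γ → WellFormed γ
IsArc⇒WellFormed γ (i<j , _ , len) = i<j , len

WellFormed⇒IsArc : ∀ {n} γ → WellFormed γ → j γ ≤ suc n → IsArc n γ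
WellFormed⇒IsArc γ (i<j , len) j≤1+n = i<j , j≤1+n , len

InRange : Arc → ℕ → Set
InRange γ x = (i γ ≤ x) × (x ≤ j γ)

private
  ∸-∸1 : ∀ m k → m ∸ k ∸ 1 ≡ m ∸ suc k
  ∸-∸1 m k = trans (∸-+-assoc m k 1) (cong (m ∸_) (+-comm k 1))

  offset<length : ∀ {γ} x → WellFormed γ → x < j γ → i γ < x → x ∸ suc (i γ) < length (side γ)
  offset<length {γ} x (_ , len) x<j i<x =
    subst (x ∸ suc (i γ) <_) (sym (trans len (∸-∸1 (j γ) (i γ)))) (∸-monoˡ-< x<j i<x)

  nth-beyond : ∀ l t → length l ≤ t → nth l t ≡ nothing
  nth-beyond []      t       _         = refl
  nth-beyond (b ∷ l) (suc t) (s≤s len≤t) = nth-beyond l t len≤t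

  nth-within : ∀ l t → t < length l → ∃[ b ] nth l t ≡ just b
  nth-within (b ∷ l) zero    _         = b , refl
  nth-within (b ∷ l) (suc t) (s≤s t<len) = nth-within l t t<len

  nth-applyUpTo : ∀ (h : ℕ → Bool) m t → t < m → nth (applyUpTo h m) t ≡ just (h t)
  nth-applyUpTo h (suc m) zero    _         = refl
  nth-applyUpTo h (suc m) (suc t) (s≤s t<m) = nth-applyUpTo (λ u → h (suc u)) m t t<m

  <ᵇ-false : ∀ {m n} → n ≤ m → (m <ᵇ n) ≡ false
  <ᵇ-false n≤m = dec-false (_ <? _) (≤⇒≯ n≤m)

level-≤i : ∀ γ x → x ≤ i γ → level γ x ≡ through
level-≤i γ x x≤i rewrite <ᵇ-false x≤i = refl

level-≥j : ∀ γ x → WellFormed γ → j γ ≤ x → level γ x ≡ through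
level-≥j γ x (_ , len) j≤x with i γ <ᵇ x
... | false = refl
... | true  = cong levelOf (nth-beyond (side γ) (x ∸ suc (i γ))
                 (subst (_≤ x ∸ suc (i γ)) (sym (trans len (∸-∸1 (j γ) (i γ)))) (∸-monoˡ-≤ (suc (i γ)) j≤x)))

level-interior : ∀ γ x → WellFormed γ → i γ < x → x < j γ → level γ x ≢ through
level-interior γ x wf i<x x<j
  rewrite dec-true (i γ <? x) i<x
  with nth-within (side γ) (x ∸ suc (i γ)) (offset<length {γ} x wf x<j i<x)
... | true  , e rewrite e = λ ()
... | false , e rewrite e = λ ()

level-i : ∀ γ → level γ (i γ) ≡ through
level-i γ = level-≤i γ (i γ) ≤-refl

level-j : ∀ γ → WellFormed γ → level γ (j γ) ≡ through
level-j γ wf = level-≥j γ (j γ) wf ≤-refl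

level≢through⇒interior : ∀ γ x → WellFormed γ → level γ x ≢ through → (i γ < x) × (x < j γ)
level≢through⇒interior γ x wf ≢through with i γ <? x | x <? j γ
... | yes i<x | yes x<j = i<x , x<j
... | no i≮x  | _       = ⊥-elim (≢through (level-≤i γ x (≮⇒≥ i≮x)))
... | yes _   | no x≮j  = ⊥-elim (≢through (level-≥j γ x wf (≮⇒≥ x≮j)))

level≢through⇒InRange : ∀ γ x → WellFormed γ → level γ x ≢ through → InRange γ x
level≢through⇒InRange γ x wf ≢through =
  let i<x , x<j = level≢through⇒interior γ x wf ≢through in <⇒≤ i<x , <⇒≤ x<j

data Position (l r x : ℕ) : Set where
  at-left  : x ≡ l → Position l r x
  inside   : l < x → x < r → Position l r x
  at-right : x ≡ r → Position l r x

position : ∀ {l r x} → l ≤ x → x ≤ r → Position l r x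
position l≤x x≤r with m≤n⇒m<n∨m≡n l≤x | m≤n⇒m<n∨m≡n x≤r
... | inj₂ l≡x | _         = at-left (sym l≡x)
... | inj₁ _   | inj₂ x≡r  = at-right x≡r
... | inj₁ l<x | inj₁ x<r  = inside l<x x<r

level-through⇒endpoint : ∀ γ x → WellFormed γ → InRange γ x → level γ x ≡ through → x ≡ i γ ⊎ x ≡ j γ
level-through⇒endpoint γ x wf (i≤x , x≤j) ≡through with position i≤x x≤j
... | at-left x≡i    = inj₁ x≡i
... | inside i<x x<j = ⊥-elim (level-interior γ x wf i<x x<j ≡through)
... | at-right x≡j   = inj₂ x≡j

InRange-i : ∀ γ → WellFormed γ → InRange γ (i γ)
InRange-i γ (i<j , _) = ≤-refl , <⇒≤ i<j

InRange-j : ∀ γ → WellFormed γ → InRange γ (j γ)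
InRange-j γ (i<j , _) = <⇒≤ i<j , ≤-refl

mkArc-wellFormed : ∀ a b f → a < b → WellFormed (mkArc a b f)
mkArc-wellFormed a b f a<b = a<b , trans (length-map _ (upTo (b ∸ a ∸ 1))) (length-upTo _)

sideOf-mkArc : ∀ a b f x → a < x → x < b → sideOf (mkArc a b f) x ≡ just (f x)
sideOf-mkArc a b f x a<x x<b
  rewrite dec-true (a <? x) a<x
        | map-applyUpTo (λ u → u) (λ t → f (suc a + t)) (b ∸ a ∸ 1)
        | nth-applyUpTo (λ t → f (suc a + t)) (b ∸ a ∸ 1) (x ∸ suc a)
            (subst (x ∸ suc a <_) (sym (∸-∸1 b a)) (∸-monoˡ-< x<b a<x))
        | m+[n∸m]≡n a<x = refl

level-mkArc : ∀ l r f x → l < x → x < r → level (mkArc l r f) x ≡ levelOf (just (f x))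
level-mkArc l r f x l<x x<r = cong levelOf (sideOf-mkArc l r f x l<x x<r)

-- Crossing and compatibility in terms of levels

Above : Arc → Arc → ℕ → Set
Above γ δ x = InRange γ x × InRange δ x × level δ x <ˡ level γ x

Above-irrefl : ∀ γ x → ¬ Above γ γ x
Above-irrefl γ x (_ , _ , o) = <ˡ-irrefl o

Above-asym : ∀ γ δ x → Above γ δ x → ¬ Above δ γ x
Above-asym γ δ x (_ , _ , o) (_ , _ , o′) = <ˡ-asym o o′

CrossSideAt : Arc → Arc → ℕ → Set
CrossSideAt γ δ k =
  (k ∈A γ × k ∈B δ)
  ⊎ (((k ≡ i γ) ⊎ (k ≡ j γ)) × k ∈B δ)
  ⊎ (k ∈A γ × ((k ≡ i δ) ⊎ (k ≡ j δ)))

private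
  endpoint-through : ∀ γ x → WellFormed γ → (x ≡ i γ) ⊎ (x ≡ j γ) → level γ x ≡ through × InRange γ x
  endpoint-through γ x wf (inj₁ refl) = level-i γ , InRange-i γ wf
  endpoint-through γ x wf (inj₂ refl) = level-j γ wf , InRange-j γ wf

  above-InRange : ∀ γ x → WellFormed γ → level γ x ≡ above → InRange γ x
  above-InRange γ x wf e = level≢through⇒InRange γ x wf (λ e′ → above≢through (trans (sym e) e′))

  below-InRange : ∀ γ x → WellFormed γ → level γ x ≡ below → InRange γ x
  below-InRange γ x wf e = level≢through⇒InRange γ x wf (λ e′ → below≢through (trans (sym e) e′))

CrossSideAt⇒Above : ∀ γ δ k → WellFormed γ → WellFormed δ → CrossSideAt γ δ k → Above γ δ k
CrossSideAt⇒Above γ δ k wfγ wfδ (inj₁ (k∈Aγ , k∈Bδ)) =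
  above-InRange γ k wfγ (∈A⇒above γ k k∈Aγ) , below-InRange δ k wfδ (∈B⇒below δ k k∈Bδ) ,
  <ˡ-cast (∈B⇒below δ k k∈Bδ) (∈A⇒above γ k k∈Aγ) below<above
CrossSideAt⇒Above γ δ k wfγ wfδ (inj₂ (inj₁ (k-end , k∈Bδ))) =
  let ≡through , inRange = endpoint-through γ k wfγ k-end in
  inRange , below-InRange δ k wfδ (∈B⇒below δ k k∈Bδ) ,
  <ˡ-cast (∈B⇒below δ k k∈Bδ) ≡through below<through
CrossSideAt⇒Above γ δ k wfγ wfδ (inj₂ (inj₂ (k∈Aγ , k-end))) =
  let ≡through , inRange = endpoint-through δ k wfδ k-end in
  above-InRange γ k wfγ (∈A⇒above γ k k∈Aγ) , inRange ,
  <ˡ-cast ≡through (∈A⇒above γ k k∈Aγ) through<above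

Above⇒CrossSideAt : ∀ γ δ x → WellFormed γ → WellFormed δ → Above γ δ x → CrossSideAt γ δ x
Above⇒CrossSideAt γ δ x wfγ wfδ (inγ , inδ , o) = go (level δ x) (level γ x) refl refl o
  where
  go : ∀ u w → level δ x ≡ u → level γ x ≡ w → u <ˡ w → CrossSideAt γ δ x
  go .below .through eδ eγ below<through =
    inj₂ (inj₁ (level-through⇒endpoint γ x wfγ inγ eγ , below⇒∈B δ x eδ))
  go .below .above eδ eγ below<above = inj₁ (above⇒∈A γ x eγ , below⇒∈B δ x eδ)
  go .through .above eδ eγ through<above =
    inj₂ (inj₂ (above⇒∈A γ x eγ , level-through⇒endpoint δ x wfδ inδ eδ))

CrossSideAt-starts : ∀ γ δ k → (k ∈A γ × k ∈B δ) ⊎ ((k ≡ i γ) × k ∈B δ) ⊎ (k ∈A γ × (k ≡ i δ)) → CrossSideAt γ δ k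
CrossSideAt-starts γ δ k = Sum.map₂ (Sum.map (Product.map₁ inj₁) (Product.map₂ inj₁))

CrossSideAt-ends : ∀ γ δ k → (k ∈A γ × k ∈B δ) ⊎ ((k ≡ j γ) × k ∈B δ) ⊎ (k ∈A γ × (k ≡ j δ)) → CrossSideAt γ δ k
CrossSideAt-ends γ δ k = Sum.map₂ (Sum.map (Product.map₁ inj₂) (Product.map₂ inj₂))

Compatible′ : Arc → Arc → Set
Compatible′ γ δ = ¬ NonPointed γ δ × (∀ x y → Above γ δ x → Above δ γ y → ⊥)

Compatible⇒Compatible′ : ∀ γ δ → WellFormed γ → WellFormed δ → Compatible γ δ → Compatible′ γ δ
Compatible⇒Compatible′ γ δ wfγ wfδ (¬np , ¬cr) =
  ¬np , λ x y γ>δ δ>γ → ¬cr ((x , Above⇒CrossSideAt γ δ x wfγ wfδ γ>δ) , (y , Above⇒CrossSideAt δ γ y wfδ wfγ δ>γ))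

Compatible′⇒Compatible : ∀ γ δ → WellFormed γ → WellFormed δ → Compatible′ γ δ → Compatible γ δ
Compatible′⇒Compatible γ δ wfγ wfδ (¬np , ¬cr) =
  ¬np , λ { ((x , γ>δ) , (y , δ>γ)) → ¬cr x y (CrossSideAt⇒Above γ δ x wfγ wfδ γ>δ) (CrossSideAt⇒Above δ γ y wfδ wfγ δ>γ) }

Compatible′-sym : ∀ γ δ → Compatible′ γ δ → Compatible′ δ γ
Compatible′-sym γ δ (¬np , ¬cr) = (λ np → ¬np (swap np)) , λ x y δ>γ γ>δ → ¬cr y x γ>δ δ>γ
  where
  swap : NonPointed δ γ → NonPointed γ δ
  swap (inj₁ e) = inj₂ e
  swap (inj₂ e) = inj₁ e

Compatible′-refl : ∀ γ → WellFormed γ → Compatible′ γ γ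
Compatible′-refl γ (i<j , _) = ¬np , λ x _ γ>γ _ → Above-irrefl γ x γ>γ
  where
  ¬np : ¬ NonPointed γ γ
  ¬np (inj₁ e) = <⇒≢ i<j e
  ¬np (inj₂ e) = <⇒≢ i<j e

flipArc : Arc → Arc
flipArc γ = arc (i γ) (j γ) (map not (side γ))

private
  nth-map-not : ∀ l t → nth (map not l) t ≡ Data.Maybe.map not (nth l t)
  nth-map-not []      t       = refl
  nth-map-not (b ∷ l) zero    = refl
  nth-map-not (b ∷ l) (suc t) = nth-map-not l t

  levelOf-map-not : ∀ m → levelOf (Data.Maybe.map not m) ≡ negate (levelOf m)
  levelOf-map-not nothing      = refl
  levelOf-map-not (just true)  = refl
  levelOf-map-not (just false) = refl

level-flip : ∀ γ x → level (flipArc γ) x ≡ negate (level γ x)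
level-flip γ x with i γ <ᵇ x
... | false = refl
... | true  = trans (cong levelOf (nth-map-not (side γ) (x ∸ suc (i γ))))
                    (levelOf-map-not (nth (side γ) (x ∸ suc (i γ))))

WellFormed-flip : ∀ γ → WellFormed γ → WellFormed (flipArc γ)
WellFormed-flip γ (i<j , len) = i<j , trans (length-map not (side γ)) len

Above-flip : ∀ γ δ x → Above γ δ x → Above (flipArc δ) (flipArc γ) x
Above-flip γ δ x (inγ , inδ , o) = inδ , inγ , <ˡ-cast (level-flip γ x) (level-flip δ x) (negate-<ˡ o)

Above-unflip : ∀ γ δ x → Above (flipArc δ) (flipArc γ) x → Above γ δ x
Above-unflip γ δ x (inδ , inγ , o) =
  inγ , inδ , negate-<ˡ⁻¹ (<ˡ-cast (sym (level-flip γ x)) (sym (level-flip δ x)) o)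

Compatible′-flip : ∀ γ δ → Compatible′ γ δ → Compatible′ (flipArc γ) (flipArc δ)
Compatible′-flip γ δ (¬np , ¬cr) =
  ¬np , λ x y γ>δ δ>γ → ¬cr y x (Above-unflip γ δ y δ>γ) (Above-unflip δ γ x γ>δ)

Compatible′-unflip : ∀ γ δ → Compatible′ (flipArc γ) (flipArc δ) → Compatible′ γ δ
Compatible′-unflip γ δ (¬np , ¬cr) =
  ¬np , λ x y γ>δ δ>γ → ¬cr y x (Above-flip δ γ y δ>γ) (Above-flip γ δ x γ>δ)

-- Arcs forced into a pseudotriangulation by maximality

Inherits : Arc → Arc → Arc → Set
Inherits a b γ = ∀ δ → WellFormed δ → Compatible′ δ a → Compatible′ δ b → Compatible′ δ γ

record TightSwitch (a b : Arc) (q : ℕ) : Set where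
  field
    left        : ℕ
    right       : ℕ
    q≤left      : q ≤ left
    left<right  : left < right
    b-above     : Above b a left
    a-above     : Above a b right
    agree       : ∀ z → left < z → z < right → level a z ≡ level b z

TightSwitch-weaken : ∀ {a b q q′} → q ≤ q′ → TightSwitch a b q′ → TightSwitch a b q
TightSwitch-weaken q≤q′ sw = record { TightSwitch sw ; q≤left = ≤-trans q≤q′ (TightSwitch.q≤left sw) }

InRange-between : ∀ γ {q r z} → InRange γ q → InRange γ r → q ≤ z → z ≤ r → InRange γ z
InRange-between γ (i≤q , _) (_ , r≤j) q≤z z≤r = ≤-trans i≤q q≤z , ≤-trans z≤r r≤j

module _ (a b : Arc) where

  private
    InRange-both : ∀ {q z r} → q ≤ z → z ≤ r → Above b a q → Above a b r → InRange a z × InRange b z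
    InRange-both q≤z z≤r (in-b , in-a , _) (in-a′ , in-b′ , _) =
      InRange-between a in-a in-a′ q≤z z≤r , InRange-between b in-b in-b′ q≤z z≤r

    -- scan s = q + 1, q + 2, ... towards r, keeping q the last point seen where b is above a
    scan : ∀ m q s r → r ≡ suc (s + m) → q ≤ s → Above b a q → Above a b r
         → (∀ z → q < z → z ≤ s → level a z ≡ level b z) → TightSwitch a b q
    scan zero q s r r≡ q≤s b>a a>b agree = record
      { left = q ; right = r ; q≤left = ≤-refl ; left<right = q<r ; b-above = b>a ; a-above = a>b
      ; agree = λ z q<z z<r → agree z q<z (≤-pred (subst (z <_) r≡1+s z<r)) }
      where
      r≡1+s : r ≡ suc s
      r≡1+s = trans r≡ (cong suc (+-identityʳ s))
      q<r : q < r
      q<r = subst (q <_) (sym r≡1+s) (s≤s q≤s)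
    scan (suc m) q s r r≡ q≤s b>a a>b agree
      with <ˡ-cmp (level a (suc s)) (level b (suc s))
         | InRange-both (≤-trans q≤s (n≤1+n s)) (subst (suc s ≤_) (sym r≡) (s≤s (m≤m+n s (suc m)))) b>a a>b
    ... | inj₁ b-higher | in-a , in-b =
          TightSwitch-weaken (≤-trans q≤s (n≤1+n s))
            (scan m (suc s) (suc s) r (trans r≡ (cong suc (+-suc s m))) ≤-refl (in-b , in-a , b-higher) a>b
                  (λ z 1+s<z z≤1+s → ⊥-elim (<⇒≱ 1+s<z z≤1+s)))
    ... | inj₂ (inj₂ a-higher) | in-a , in-b = record
          { left = q ; right = suc s ; q≤left = ≤-refl ; left<right = s≤s q≤s ; b-above = b>a
          ; a-above = in-a , in-b , a-higher ; agree = λ z q<z z<1+s → agree z q<z (≤-pred z<1+s) }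
    ... | inj₂ (inj₁ equal) | _ =
          scan m q (suc s) r (trans r≡ (cong suc (+-suc s m))) (≤-trans q≤s (n≤1+n s)) b>a a>b agree′
      where
      agree′ : ∀ z → q < z → z ≤ suc s → level a z ≡ level b z
      agree′ z q<z z≤1+s with m≤n⇒m<n∨m≡n z≤1+s
      ... | inj₁ z<1+s = agree z q<z (≤-pred z<1+s)
      ... | inj₂ refl  = equal

  tightSwitch : ∀ q r → q < r → Above b a q → Above a b r → TightSwitch a b q
  tightSwitch q r q<r b>a a>b =
    scan (r ∸ suc q) q q r (sym (m+[n∸m]≡n q<r)) ≤-refl b>a a>b (λ z q<z z≤q → ⊥-elim (<⇒≱ q<z z≤q))

-- Cutting a at the left end of a tight switch yields an arc that is compatible with a
-- and with everything compatible with a and b, but that crosses b.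
module Cut (a b : Arc) (wfa : WellFormed a) (wfb : WellFormed b) {p : ℕ}
           (a>b : Above a b p) (sw : TightSwitch a b (suc p)) where

  open TightSwitch sw renaming (left to q; right to r)

  ia<q : i a < q
  ia<q = ≤-<-trans (proj₁ (proj₁ a>b)) q≤left
  ib<q : i b < q
  ib<q = ≤-<-trans (proj₁ (proj₁ (proj₂ a>b))) q≤left
  q<ja : q < j a
  q<ja = <-≤-trans left<right (proj₂ (proj₁ a-above))
  q<jb : q < j b
  q<jb = <-≤-trans left<right (proj₂ (proj₁ (proj₂ a-above)))

  a-below-b-above : level a q ≡ below × level b q ≡ above
  a-below-b-above = <ˡ-off-through (level-interior a q wfa ia<q q<ja) (level-interior b q wfb ib<q q<jb)
                                   (proj₂ (proj₂ b-above))

  cut : Arc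
  cut = mkArc (i a) q (isA a)

  cut-wellFormed : WellFormed cut
  cut-wellFormed = mkArc-wellFormed (i a) q (isA a) ia<q

  level-cut : ∀ x → i a ≤ x → x < q → level cut x ≡ level a x
  level-cut x ia≤x x<q with m≤n⇒m<n∨m≡n ia≤x
  ... | inj₂ refl = trans (level-i cut) (sym (level-i a))
  ... | inj₁ ia<x = begin
    level cut x                ≡⟨ level-mkArc (i a) q (isA a) x ia<x x<q ⟩
    levelOf (just (isA a x))   ≡⟨ cong (levelOf ∘ just) (isA≡isAbove a x) ⟩
    upper through (level a x)  ≡⟨ through-upper (level a x) (level-interior a x wfa ia<x (<-trans x<q q<ja)) ⟩
    level a x                  ∎

  cut≢a : cut ≢ a
  cut≢a e = <⇒≢ q<ja (cong j e)

  InRange-a-q : InRange a q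
  InRange-a-q = <⇒≤ ia<q , <⇒≤ q<ja

  InRange-b-q : InRange b q
  InRange-b-q = <⇒≤ ib<q , <⇒≤ q<jb

  cut-compatible-a : Compatible′ cut a
  cut-compatible-a = ¬np , λ _ y _ a>cut → a-not-above y a>cut
    where
    ¬np : ¬ NonPointed cut a
    ¬np (inj₁ e) = <⇒≢ (proj₁ wfa) e
    ¬np (inj₂ e) = <⇒≢ ia<q e
    a-not-above : ∀ y → ¬ Above a cut y
    a-not-above y (_ , in-cut , o) with m≤n⇒m<n∨m≡n (proj₂ in-cut)
    ... | inj₁ y<q = <ˡ-irrefl (<ˡ-cast (sym (level-cut y (proj₁ in-cut) y<q)) refl o)
    ... | inj₂ refl = ≮below (proj₁ a-below-b-above) (<ˡ-cast (sym (level-j cut cut-wellFormed)) refl o)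

  cut-crosses-b : ¬ Compatible′ cut b
  cut-crosses-b (_ , ¬cr) = ¬cr p q cut>b b>cut
    where
    cut>b : Above cut b p
    cut>b = let (ia≤p , _) , in-b , b<a = a>b in
            (ia≤p , <⇒≤ q≤left) , in-b , <ˡ-cast refl (level-cut p ia≤p q≤left) b<a
    b>cut : Above b cut q
    b>cut = InRange-b-q , InRange-j cut cut-wellFormed ,
            <ˡ-cast (level-j cut cut-wellFormed) (proj₂ a-below-b-above) through<above

  private
    -- δ cannot reach r, where a is above b, so it ends at a point where a and b agree
    trapped : ∀ δ → WellFormed δ → (∀ z → ¬ Above a δ z) → (∀ z → ¬ Above δ b z)
            → i δ ≤ q → q < j δ → ⊥
    trapped δ wfδ a≯δ δ≯b iδ≤q q<jδ with r ≤? j δ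
    ... | yes r≤jδ = [ (λ δ<a → a≯δ r (proj₁ a-above , in-δ , δ<a)) , (λ b<δ → δ≯b r (in-δ , proj₁ (proj₂ a-above) , b<δ)) ]′
                       (<ˡ-cotrans (level δ r) (proj₂ (proj₂ a-above)))
      where
      in-δ : InRange δ r
      in-δ = ≤-trans iδ≤q (<⇒≤ left<right) , r≤jδ
    ... | no r≰jδ = ends-inside (≰⇒> r≰jδ)
      where
      ends-inside : j δ < r → ⊥
      ends-inside jδ<r
        with <ˡ-cmp (level a (j δ)) through
           | <-≤-trans jδ<r (proj₂ (proj₁ a-above)) | <-≤-trans jδ<r (proj₂ (proj₁ (proj₂ a-above)))
      ... | inj₁ a-below | _ | jδ<jb =
            δ≯b (j δ) (InRange-j δ wfδ , (<⇒≤ (<-trans ib<q q<jδ) , <⇒≤ jδ<jb) ,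
                       <ˡ-cast (sym (agree (j δ) q<jδ jδ<r)) (level-j δ wfδ) a-below)
      ... | inj₂ (inj₁ a-through) | jδ<ja | _ = level-interior a (j δ) wfa (<-trans ia<q q<jδ) jδ<ja a-through
      ... | inj₂ (inj₂ a-above-δ) | jδ<ja | _ =
            a≯δ (j δ) ((<⇒≤ (<-trans ia<q q<jδ) , <⇒≤ jδ<ja) , InRange-j δ wfδ , <ˡ-cast (level-j δ wfδ) refl a-above-δ)

  cut-inherits : Inherits a b cut
  cut-inherits δ wfδ (¬np-a , a-cr) (¬np-b , b-cr) = ¬np , ¬cr
    where
    ¬np : ¬ NonPointed δ cut
    ¬np (inj₂ e) = ¬np-a (inj₂ e)
    ¬np (inj₁ iδ≡q) = trapped δ wfδ (λ z → a-cr q z δ>a) (λ z b<δ → b-cr z q b<δ b>δ)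
                        (≤-reflexive iδ≡q) (subst (_< j δ) iδ≡q (proj₁ wfδ))
      where
      in-δ : InRange δ q
      in-δ = subst (InRange δ) iδ≡q (InRange-i δ wfδ)
      δ-through : level δ q ≡ through
      δ-through = subst (λ t → level δ t ≡ through) iδ≡q (level-i δ)
      δ>a : Above δ a q
      δ>a = in-δ , InRange-a-q , <ˡ-cast (proj₁ a-below-b-above) δ-through below<through
      b>δ : Above b δ q
      b>δ = InRange-b-q , in-δ , <ˡ-cast δ-through (proj₂ a-below-b-above) through<above
    ¬cr : ∀ x y → Above δ cut x → Above cut δ y → ⊥
    ¬cr x y (in-δx , in-cut-x , cut<δ) (in-cut-y , in-δy , δ<cut) = below-cut δ>a
      where
      δ>a : Σ ℕ (Above δ a)
      δ>a with m≤n⇒m<n∨m≡n (proj₂ in-cut-x)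
      ... | inj₁ x<q = x , in-δx , (proj₁ in-cut-x , <⇒≤ (<-trans x<q q<ja)) ,
                       <ˡ-cast (sym (level-cut x (proj₁ in-cut-x) x<q)) refl cut<δ
      ... | inj₂ refl = q , in-δx , InRange-a-q ,
                        <ˡ-cast (proj₁ a-below-b-above) refl
                          (through<⇒below< (<ˡ-cast (sym (level-j cut cut-wellFormed)) refl cut<δ))
      below-cut : Σ ℕ (Above δ a) → ⊥
      below-cut (x′ , δ>a′) with m≤n⇒m<n∨m≡n (proj₂ in-cut-y)
      ... | inj₁ y<q = a-cr x′ y δ>a′ ((proj₁ in-cut-y , <⇒≤ (<-trans y<q q<ja)) , in-δy ,
                                       <ˡ-cast refl (sym (level-cut y (proj₁ in-cut-y) y<q)) δ<cut)
      ... | inj₂ refl =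
            let δ-below = <through⇒below (level-j cut cut-wellFormed) δ<cut
                iδ<q , q<jδ = level≢through⇒interior δ q wfδ (λ e → below≢through (trans (sym δ-below) e))
                b>δ : Above b δ q
                b>δ = InRange-b-q , in-δy , <ˡ-cast δ-below (proj₂ a-below-b-above) below<above
            in trapped δ wfδ (λ z → a-cr x′ z δ>a′) (λ z b<δ → b-cr z q b<δ b>δ) (<⇒≤ iδ<q) q<jδ

_≟ᵃ_ : (γ δ : Arc) → Dec (γ ≡ δ)
arc a b s ≟ᵃ arc a′ b′ s′ with a ≟ a′ | b ≟ b′ | ≡-dec _≟ᵇ_ s s′
... | yes refl | yes refl | yes refl = yes refl
... | no a≢a′  | _        | _        = no λ e → a≢a′ (cong i e)
... | yes _    | no b≢b′  | _        = no λ e → b≢b′ (cong j e)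
... | yes _    | yes _    | no s≢s′  = no λ e → s≢s′ (cong side e)

maximality : ∀ {n T} → IsWigglyPT n T → ∀ a b γ → T a → (∀ δ → T δ → δ ≢ a → Compatible′ δ b)
           → IsArc n γ → Compatible′ γ a → Inherits a b γ → T γ
maximality {T = T} PT a b γ Ta T∖a-compatible-b arcγ γ-a γ-inherits =
  IsWigglyPT.maximal PT γ arcγ compatible
  where
  wfγ : WellFormed γ
  wfγ = IsArc⇒WellFormed γ arcγ
  wf : ∀ δ → T δ → WellFormed δ
  wf δ Tδ = IsArc⇒WellFormed δ (IsWigglyPT.valid PT δ Tδ)
  compatible : ∀ δ → T δ ⊎ δ ≡ γ → Compatible γ δ
  compatible δ (inj₂ refl) = Compatible′⇒Compatible γ γ wfγ wfγ (Compatible′-refl γ wfγ)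
  compatible δ (inj₁ Tδ) with δ ≟ᵃ a
  ... | yes refl = Compatible′⇒Compatible γ a wfγ (wf a Ta) γ-a
  ... | no δ≢a   = Compatible′⇒Compatible γ δ wfγ (wf δ Tδ)
                     (Compatible′-sym δ γ (γ-inherits δ (wf δ Tδ) δ-a (T∖a-compatible-b δ Tδ δ≢a)))
    where
    δ-a : Compatible′ δ a
    δ-a = Compatible⇒Compatible′ δ a (wf δ Tδ) (wf a Ta) (IsWigglyPT.pairwise PT δ a Tδ Ta)

module FlipSide (n : ℕ) (T T′ : ArcSet) (PT : IsWigglyPT n T) (PT′ : IsWigglyPT n T′)
                (a b : Arc) (Ta : T a) (T′b : T′ b)
                (same : ∀ γ → (T γ × γ ≢ a) ⇔ (T′ γ × γ ≢ b)) where

  wf-a : WellFormed a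
  wf-a = IsArc⇒WellFormed a (IsWigglyPT.valid PT a Ta)

  wf-b : WellFormed b
  wf-b = IsArc⇒WellFormed b (IsWigglyPT.valid PT′ b T′b)

  T⇒T′ : ∀ γ → T γ → γ ≢ a → T′ γ
  T⇒T′ γ Tγ γ≢a = proj₁ (Equivalence.to (same γ) (Tγ , γ≢a))

  T⇒compatible-b : ∀ γ → T γ → γ ≢ a → WellFormed γ → Compatible′ γ b
  T⇒compatible-b γ Tγ γ≢a wfγ =
    Compatible⇒Compatible′ γ b wfγ wf-b (IsWigglyPT.pairwise PT′ γ b (T⇒T′ γ Tγ γ≢a) T′b)

  ∈T : ∀ γ → IsArc n γ → Compatible′ γ a → Inherits a b γ → T γ
  ∈T γ = maximality PT a b γ Ta
           (λ δ Tδ δ≢a → T⇒compatible-b δ Tδ δ≢a (IsArc⇒WellFormed δ (IsWigglyPT.valid PT δ Tδ)))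

  no-cut : ∀ {p} → Above a b p → TightSwitch a b (suc p) → ⊥
  no-cut a>b sw =
    cut-crosses-b (T⇒compatible-b cut (∈T cut arc-cut cut-compatible-a cut-inherits) cut≢a cut-wellFormed)
    where
    open Cut a b wf-a wf-b a>b sw
    arc-cut : IsArc n cut
    arc-cut = WellFormed⇒IsArc cut cut-wellFormed (<⇒≤ (<-≤-trans q<ja (proj₁ (proj₂ (IsWigglyPT.valid PT a Ta)))))

record SurvivesFlip (a b γ : Arc) : Set where
  field
    compatible-a : Compatible′ γ a
    compatible-b : Compatible′ γ b
    inherits     : Inherits a b γ

SurvivesFlip-swap : ∀ {a b γ} → SurvivesFlip a b γ → SurvivesFlip b a γ
SurvivesFlip-swap s = record
  { compatible-a = compatible-b ; compatible-b = compatible-a ; inherits = λ δ wfδ δ-b δ-a → inherits δ wfδ δ-a δ-b }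
  where open SurvivesFlip s

SurvivesFlip-unflip : ∀ {a b γ} → SurvivesFlip (flipArc a) (flipArc b) (flipArc γ) → SurvivesFlip a b γ
SurvivesFlip-unflip {a} {b} {γ} s = record
  { compatible-a = Compatible′-unflip γ a compatible-a
  ; compatible-b = Compatible′-unflip γ b compatible-b
  ; inherits = λ δ wfδ δ-a δ-b → Compatible′-unflip δ γ
      (inherits (flipArc δ) (WellFormed-flip δ wfδ) (Compatible′-flip δ a δ-a) (Compatible′-flip δ b δ-b)) }
  where open SurvivesFlip s

-- Compatibility of the arcs β and β′

crossing-overlap : ∀ a b {k ℓ} → k < ℓ → Above a b k → Above b a ℓ → i b < j a × i a < j b
crossing-overlap a b k<ℓ ((ia≤k , _) , (ib≤k , _) , _) ((_ , ℓ≤jb) , (_ , ℓ≤ja) , _) =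
  ≤-<-trans ib≤k (<-≤-trans k<ℓ ℓ≤ja) , ≤-<-trans ia≤k (<-≤-trans k<ℓ ℓ≤jb)

-- c is β₂ a b, or the reflection of β₂' a b with the roles of a and b exchanged.
module CrossingCore (a b : Arc) (wfa : WellFormed a) (wfb : WellFormed b) {k ℓ : ℕ} (k<ℓ : k < ℓ)
                    (a>b : Above a b k) (b>a : Above b a ℓ)
                    (single : ∀ x y → x < y → Above b a x → Above a b y → ⊥)
                    (s : List Bool) (wfc : WellFormed (arc (i b) (j a) s))
                    (level-c : ∀ x → i b < x → x < j a → level (arc (i b) (j a) s) x ≡ lower (level a x) (level b x))
                    where

  c : Arc
  c = arc (i b) (j a) s

  ib<ja : i b < j a
  ib<ja = proj₁ (crossing-overlap a b k<ℓ a>b b>a)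

  ia<jb : i a < j b
  ia<jb = proj₂ (crossing-overlap a b k<ℓ a>b b>a)

  b≯a-before : ∀ z → z ≤ k → ¬ Above b a z
  b≯a-before z z≤k b>a-z with m≤n⇒m<n∨m≡n z≤k
  ... | inj₁ z<k  = single z k z<k b>a-z a>b
  ... | inj₂ refl = Above-asym a b z a>b b>a-z

  a≯b-after : ∀ z → ℓ ≤ z → ¬ Above a b z
  a≯b-after z ℓ≤z a>b-z with m≤n⇒m<n∨m≡n ℓ≤z
  ... | inj₁ ℓ<z  = single ℓ z ℓ<z b>a a>b-z
  ... | inj₂ refl = Above-asym a b z a>b-z b>a

  ib≤k : i b ≤ k
  ib≤k = proj₁ (proj₁ (proj₂ a>b))

  ia≤k : i a ≤ k
  ia≤k = proj₁ (proj₁ a>b)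

  ℓ≤ja : ℓ ≤ j a
  ℓ≤ja = proj₂ (proj₁ (proj₂ b>a))

  ℓ≤jb : ℓ ≤ j b
  ℓ≤jb = proj₂ (proj₁ b>a)

  c-through-ib : level c (i b) ≡ through
  c-through-ib = level-i c

  c-through-ja : level c (j a) ≡ through
  c-through-ja = level-j c wfc

  level-c-cases : ∀ x → i b < x → x < j a
                → (level c x ≡ below × (level a x ≡ below ⊎ level b x ≡ below))
                ⊎ (level c x ≡ above × level a x ≢ below × level b x ≢ below)
  level-c-cases x ib<x x<ja rewrite level-c x ib<x x<ja = lower-cases (level a x) (level b x)

  δ>c⇒δ>a⊎δ>b : ∀ δ x → Above δ c x → Above δ a x ⊎ Above δ b x
  δ>c⇒δ>a⊎δ>b δ x (in-δ , (ib≤x , x≤ja) , c<δ) with position ib≤x x≤ja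
  ... | at-left refl = inj₂ (in-δ , InRange-i b wfb , <ˡ-cast (level-i b) refl (<ˡ-cast (sym c-through-ib) refl c<δ))
  ... | at-right refl = inj₁ (in-δ , InRange-j a wfa , <ˡ-cast (level-j a wfa) refl (<ˡ-cast (sym c-through-ja) refl c<δ))
  ... | inside ib<x x<ja with level-c-cases x ib<x x<ja
  ...   | inj₁ (c-below , inj₁ a-below) =
          inj₁ (in-δ , below-InRange a x wfa a-below , <ˡ-cast (trans a-below (sym c-below)) refl c<δ)
  ...   | inj₁ (c-below , inj₂ b-below) =
          inj₂ (in-δ , below-InRange b x wfb b-below , <ˡ-cast (trans b-below (sym c-below)) refl c<δ)
  ...   | inj₂ (c-above , _) = ⊥-elim (above≮ c-above c<δ)

  c>δ⇒a>δ⊎b>δ : ∀ δ y → Above c δ y → Above a δ y ⊎ Above b δ y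
  c>δ⇒a>δ⊎b>δ δ y ((ib≤y , y≤ja) , in-δ , δ<c) with position ib≤y y≤ja
  ... | at-left refl = inj₂ (InRange-i b wfb , in-δ , <ˡ-cast refl (level-i b) (<ˡ-cast refl (sym c-through-ib) δ<c))
  ... | at-right refl = inj₁ (InRange-j a wfa , in-δ , <ˡ-cast refl (level-j a wfa) (<ˡ-cast refl (sym c-through-ja) δ<c))
  ... | inside ib<y y<ja with level-c-cases y ib<y y<ja
  ...   | inj₁ (c-below , _) = ⊥-elim (≮below c-below δ<c)
  ...   | inj₂ (c-above , a≢below , b≢below) with y <? j b
  ...     | yes y<jb =
            let b-above = ≢through≢below⇒above (level-interior b y wfb ib<y y<jb) b≢below in
            inj₂ (above-InRange b y wfb b-above , in-δ , <ˡ-cast refl (trans b-above (sym c-above)) δ<c)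
  ...     | no y≮jb =
            let a-above = ≢through≢below⇒above (level-interior a y wfa (<-≤-trans ia<jb (≮⇒≥ y≮jb)) y<ja) a≢below in
            inj₁ (above-InRange a y wfa a-above , in-δ , <ˡ-cast refl (trans a-above (sym c-above)) δ<c)

  private
    c>δ⇒≤ia : ∀ δ y → (∀ z → ¬ Above a δ z) → Above c δ y → y ≤ i a
    c>δ⇒≤ia δ y a≯δ ((ib≤y , y≤ja) , in-δ , δ<c) with y ≤? i a
    ... | yes y≤ia = y≤ia
    ... | no y≰ia with position ib≤y y≤ja
    ...   | at-right refl =
            ⊥-elim (a≯δ (j a) (InRange-j a wfa , in-δ , <ˡ-cast refl (level-j a wfa) (<ˡ-cast refl (sym c-through-ja) δ<c)))
    ...   | at-left refl with <ˡ-cmp (level a (i b)) through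
    ...     | inj₁ a-below = ⊥-elim (b≯a-before (i b) ib≤k (InRange-i b wfb , (<⇒≤ (≰⇒> y≰ia) , <⇒≤ ib<ja) ,
                                      <ˡ-cast refl (level-i b) a-below))
    ...     | inj₂ (inj₁ a-through) = ⊥-elim (level-interior a (i b) wfa (≰⇒> y≰ia) ib<ja a-through)
    ...     | inj₂ (inj₂ a-above) = ⊥-elim (a≯δ (i b) ((<⇒≤ (≰⇒> y≰ia) , <⇒≤ ib<ja) , in-δ ,
                                      <ˡ-cast (<through⇒below c-through-ib δ<c) refl (through<⇒below< a-above)))
    c>δ⇒≤ia δ y a≯δ ((ib≤y , y≤ja) , in-δ , δ<c) | no y≰ia | inside ib<y y<ja with level-c-cases y ib<y y<ja
    ...   | inj₁ (c-below , _) = ⊥-elim (≮below c-below δ<c)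
    ...   | inj₂ (c-above , a≢below , _) =
            let a-above = ≢through≢below⇒above (level-interior a y wfa (≰⇒> y≰ia) y<ja) a≢below in
            ⊥-elim (a≯δ y (above-InRange a y wfa a-above , in-δ , <ˡ-cast refl (trans a-above (sym c-above)) δ<c))

    c>δ⇒≥jb : ∀ δ y → (∀ z → ¬ Above b δ z) → Above c δ y → j b ≤ y
    c>δ⇒≥jb δ y b≯δ ((ib≤y , y≤ja) , in-δ , δ<c) with j b ≤? y
    ... | yes jb≤y = jb≤y
    ... | no jb≰y with position ib≤y y≤ja
    ...   | at-left refl =
            ⊥-elim (b≯δ (i b) (InRange-i b wfb , in-δ , <ˡ-cast refl (level-i b) (<ˡ-cast refl (sym c-through-ib) δ<c)))
    ...   | at-right refl with <ˡ-cmp (level b (j a)) through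
    ...     | inj₁ b-below = ⊥-elim (a≯b-after (j a) ℓ≤ja (InRange-j a wfa , (<⇒≤ ib<ja , <⇒≤ (≰⇒> jb≰y)) ,
                                      <ˡ-cast refl (level-j a wfa) b-below))
    ...     | inj₂ (inj₁ b-through) = ⊥-elim (level-interior b (j a) wfb ib<ja (≰⇒> jb≰y) b-through)
    ...     | inj₂ (inj₂ b-above) = ⊥-elim (b≯δ (j a) ((<⇒≤ ib<ja , <⇒≤ (≰⇒> jb≰y)) , in-δ ,
                                      <ˡ-cast (<through⇒below c-through-ja δ<c) refl (through<⇒below< b-above)))
    c>δ⇒≥jb δ y b≯δ ((ib≤y , y≤ja) , in-δ , δ<c) | no jb≰y | inside ib<y y<ja with level-c-cases y ib<y y<ja
    ...   | inj₁ (c-below , _) = ⊥-elim (≮below c-below δ<c)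
    ...   | inj₂ (c-above , _ , b≢below) =
            let b-above = ≢through≢below⇒above (level-interior b y wfb ib<y (≰⇒> jb≰y)) b≢below in
            ⊥-elim (b≯δ y (above-InRange b y wfb b-above , in-δ , <ˡ-cast refl (trans b-above (sym c-above)) δ<c))

    no-mixed-left : ∀ δ x y → (∀ z → ¬ Above a δ z) → (∀ z → ¬ Above δ b z) → Above δ a x → Above c δ y → ⊥
    no-mixed-left δ x y a≯δ δ≯b ((_ , x≤jδ) , (ia≤x , _) , _) c>δ@((ib≤y , _) , (iδ≤y , _) , δ<c) =
      go (level δ (i a)) (level b (i a)) refl refl
      where
      y≤ia = c>δ⇒≤ia δ y a≯δ c>δ
      in-δ : InRange δ (i a)
      in-δ = ≤-trans iδ≤y y≤ia , ≤-trans ia≤x x≤jδ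
      in-b : InRange b (i a)
      in-b = ≤-trans ib≤y y≤ia , <⇒≤ ia<jb
      a≯b : ∀ {w} → level b (i a) ≡ w → through <ˡ w → ⊥
      a≯b eb t<w = b≯a-before (i a) ia≤k (in-b , InRange-i a wfa , <ˡ-cast (level-i a) eb t<w)
      go : ∀ u w → level δ (i a) ≡ u → level b (i a) ≡ w → ⊥
      go below   _       eδ _  = a≯δ (i a) (InRange-i a wfa , in-δ , <ˡ-cast eδ (level-i a) below<through)
      go through below   eδ eb = δ≯b (i a) (in-δ , in-b , <ˡ-cast eb eδ below<through)
      go above   below   eδ eb = δ≯b (i a) (in-δ , in-b , <ˡ-cast eb eδ below<above)
      go above   through eδ eb = δ≯b (i a) (in-δ , in-b , <ˡ-cast eb eδ through<above)
      go _       above   _  eb = a≯b eb through<above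
      go through through eδ eb with level-through⇒endpoint b (i a) wfb in-b eb
      ... | inj₂ ia≡jb = <⇒≢ ia<jb ia≡jb
      ... | inj₁ ia≡ib =
            let y≡ib = ≤-antisym (subst (y ≤_) ia≡ib y≤ia) ib≤y
                δ-below = <through⇒below (subst (λ t → level c t ≡ through) (sym y≡ib) c-through-ib) δ<c
                δ-through = subst (λ t → level δ t ≡ through) (sym (trans y≡ib (sym ia≡ib))) eδ
            in below≢through (trans (sym δ-below) δ-through)

    no-mixed-right : ∀ δ x y → (∀ z → ¬ Above b δ z) → (∀ z → ¬ Above δ a z) → Above δ b x → Above c δ y → ⊥
    no-mixed-right δ x y b≯δ δ≯a ((iδ≤x , _) , (_ , x≤jb) , _) c>δ@((_ , y≤ja) , (_ , y≤jδ) , δ<c) =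
      go (level δ (j b)) (level a (j b)) refl refl
      where
      jb≤y = c>δ⇒≥jb δ y b≯δ c>δ
      in-δ : InRange δ (j b)
      in-δ = ≤-trans iδ≤x x≤jb , ≤-trans jb≤y y≤jδ
      in-a : InRange a (j b)
      in-a = <⇒≤ ia<jb , ≤-trans jb≤y y≤ja
      b≯a : ∀ {w} → level a (j b) ≡ w → through <ˡ w → ⊥
      b≯a ea t<w = a≯b-after (j b) ℓ≤jb (in-a , InRange-j b wfb , <ˡ-cast (level-j b wfb) ea t<w)
      go : ∀ u w → level δ (j b) ≡ u → level a (j b) ≡ w → ⊥
      go below   _       eδ _  = b≯δ (j b) (InRange-j b wfb , in-δ , <ˡ-cast eδ (level-j b wfb) below<through)
      go through below   eδ ea = δ≯a (j b) (in-δ , in-a , <ˡ-cast ea eδ below<through)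
      go above   below   eδ ea = δ≯a (j b) (in-δ , in-a , <ˡ-cast ea eδ below<above)
      go above   through eδ ea = δ≯a (j b) (in-δ , in-a , <ˡ-cast ea eδ through<above)
      go _       above   _  ea = b≯a ea through<above
      go through through eδ ea with level-through⇒endpoint a (j b) wfa in-a ea
      ... | inj₁ jb≡ia = <⇒≢ ia<jb (sym jb≡ia)
      ... | inj₂ jb≡ja =
            let y≡ja = ≤-antisym y≤ja (subst (_≤ y) jb≡ja jb≤y)
                δ-below = <through⇒below (subst (λ t → level c t ≡ through) (sym y≡ja) c-through-ja) δ<c
                δ-through = subst (λ t → level δ t ≡ through) (sym (trans y≡ja (sym jb≡ja))) eδ
            in below≢through (trans (sym δ-below) δ-through)

  c-compatible-a : Compatible′ c a
  c-compatible-a = ¬np , λ x _ c>a _ → c≯a x c>a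
    where
    ¬np : ¬ NonPointed c a
    ¬np (inj₁ ib≡ja) = <⇒≢ ib<ja ib≡ja
    ¬np (inj₂ ia≡ja) = <⇒≢ (proj₁ wfa) ia≡ja
    c≯a : ∀ x → ¬ Above c a x
    c≯a x ((ib≤x , x≤ja) , in-a , a<c) with position ib≤x x≤ja
    ... | at-left refl =
          b≯a-before (i b) ib≤k (InRange-i b wfb , in-a , <ˡ-cast refl (level-i b) (<ˡ-cast refl (sym c-through-ib) a<c))
    ... | at-right refl = <ˡ-irrefl (<ˡ-cast (sym (level-j a wfa)) (sym c-through-ja) a<c)
    ... | inside ib<x x<ja with level-c-cases x ib<x x<ja
    ...   | inj₁ (c-below , _) = ≮below c-below a<c
    ...   | inj₂ (c-above , a≢below , b≢below) with level-through⇒endpoint a x wfa in-a (<above⇒through c-above a<c a≢below)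
    ...     | inj₂ x≡ja = <⇒≢ x<ja x≡ja
    ...     | inj₁ refl =
              let b-above = ≢through≢below⇒above (level-interior b (i a) wfb ib<x ia<jb) b≢below in
              b≯a-before (i a) ia≤k (above-InRange b (i a) wfb b-above , in-a ,
                                     <ˡ-cast (level-i a) b-above through<above)

  c-compatible-b : Compatible′ c b
  c-compatible-b = ¬np , λ x _ c>b _ → c≯b x c>b
    where
    ¬np : ¬ NonPointed c b
    ¬np (inj₁ ib≡jb) = <⇒≢ (proj₁ wfb) ib≡jb
    ¬np (inj₂ ib≡ja) = <⇒≢ ib<ja ib≡ja
    c≯b : ∀ x → ¬ Above c b x
    c≯b x ((ib≤x , x≤ja) , in-b , b<c) with position ib≤x x≤ja
    ... | at-left refl = <ˡ-irrefl (<ˡ-cast (sym (level-i b)) (sym c-through-ib) b<c)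
    ... | at-right refl =
          a≯b-after (j a) ℓ≤ja (InRange-j a wfa , in-b , <ˡ-cast refl (level-j a wfa) (<ˡ-cast refl (sym c-through-ja) b<c))
    ... | inside ib<x x<ja with level-c-cases x ib<x x<ja
    ...   | inj₁ (c-below , _) = ≮below c-below b<c
    ...   | inj₂ (c-above , a≢below , b≢below) with level-through⇒endpoint b x wfb in-b (<above⇒through c-above b<c b≢below)
    ...     | inj₁ x≡ib = <⇒≢ ib<x (sym x≡ib)
    ...     | inj₂ refl =
              let a-above = ≢through≢below⇒above (level-interior a (j b) wfa ia<jb x<ja) a≢below in
              a≯b-after (j b) ℓ≤jb (above-InRange a (j b) wfa a-above , in-b ,
                                    <ˡ-cast (level-j b wfb) a-above through<above)

  c-inherits : Inherits a b c
  c-inherits δ wfδ (¬np-a , a-cr) (¬np-b , b-cr) = ¬np , ¬cr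
    where
    ¬np : ¬ NonPointed δ c
    ¬np (inj₁ iδ≡ja) = ¬np-a (inj₁ iδ≡ja)
    ¬np (inj₂ ib≡jδ) = ¬np-b (inj₂ ib≡jδ)
    ¬cr : ∀ x y → Above δ c x → Above c δ y → ⊥
    ¬cr x y δ>c c>δ with δ>c⇒δ>a⊎δ>b δ x δ>c | c>δ⇒a>δ⊎b>δ δ y c>δ
    ... | inj₁ δ>a | inj₁ a>δ = a-cr x y δ>a a>δ
    ... | inj₂ δ>b | inj₂ b>δ = b-cr x y δ>b b>δ
    ... | inj₁ δ>a | inj₂ b>δ = no-mixed-left δ x y (λ z → a-cr x z δ>a) (λ z δ>b → b-cr z y δ>b b>δ) δ>a c>δ
    ... | inj₂ δ>b | inj₁ a>δ = no-mixed-right δ x y (λ z → b-cr x z δ>b) (λ z δ>a → a-cr z y δ>a a>δ) δ>b c>δ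

  c-survives : SurvivesFlip a b c
  c-survives = record { compatible-a = c-compatible-a ; compatible-b = c-compatible-b ; inherits = c-inherits }

joined-ja<jb : ∀ a b → WellFormed b → j a ≡ i b → j a < j b
joined-ja<jb a b (ib<jb , _) ja≡ib = subst (_< j b) (sym ja≡ib) ib<jb

-- c is β₁ a b, or the reflection of β₁' a b.
module NonPointedCore (a b : Arc) (wfa : WellFormed a) (wfb : WellFormed b) (ja≡ib : j a ≡ i b)
                      (s : List Bool) (wfc : WellFormed (arc (i a) (j b) s))
                      (level-c-a : ∀ x → i a < x → x < j a → level (arc (i a) (j b) s) x ≡ level a x)
                      (level-c-ja : level (arc (i a) (j b) s) (j a) ≡ below)
                      (level-c-b : ∀ x → i b < x → x < j b → level (arc (i a) (j b) s) x ≡ level b x)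
                      where

  c : Arc
  c = arc (i a) (j b) s

  ja<jb : j a < j b
  ja<jb = joined-ja<jb a b wfb ja≡ib

  ia<jb : i a < j b
  ia<jb = <-trans (proj₁ wfa) ja<jb

  a-through-ja : level a (j a) ≡ through
  a-through-ja = level-j a wfa

  b-through-ja : level b (j a) ≡ through
  b-through-ja = subst (λ t → level b t ≡ through) (sym ja≡ib) (level-i b)

  InRange-b-ja : InRange b (j a)
  InRange-b-ja = ≤-reflexive (sym ja≡ib) , <⇒≤ ja<jb

  -- an endpoint of δ at j a = i b would make δ non pointed with a or b
  at-ja : ∀ δ → WellFormed δ → ¬ NonPointed δ a → ¬ NonPointed δ b → InRange δ (j a)
        → (Above a δ (j a) × Above b δ (j a)) ⊎ (Above δ a (j a) × Above δ b (j a))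
  at-ja δ wfδ ¬np-a ¬np-b in-δ with <ˡ-cmp (level δ (j a)) through
  ... | inj₁ δ-below = inj₁ ((InRange-j a wfa , in-δ , <ˡ-cast refl a-through-ja δ-below) ,
                             (InRange-b-ja , in-δ , <ˡ-cast refl b-through-ja δ-below))
  ... | inj₂ (inj₂ δ-above) = inj₂ ((in-δ , InRange-j a wfa , <ˡ-cast a-through-ja refl δ-above) ,
                                    (in-δ , InRange-b-ja , <ˡ-cast b-through-ja refl δ-above))
  ... | inj₂ (inj₁ δ-through) with level-through⇒endpoint δ (j a) wfδ in-δ δ-through
  ...   | inj₁ ja≡iδ = ⊥-elim (¬np-a (inj₁ (sym ja≡iδ)))
  ...   | inj₂ ja≡jδ = ⊥-elim (¬np-b (inj₂ (trans (sym ja≡ib) ja≡jδ)))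

  data Part (x : ℕ) : Set where
    part-a  : InRange a x → level c x ≡ level a x → Part x
    part-ja : x ≡ j a → Part x
    part-b  : InRange b x → level c x ≡ level b x → Part x

  part : ∀ x → InRange c x → Part x
  part x (ia≤x , x≤jb) with <-cmp x (j a)
  ... | tri≈ _ x≡ja _ = part-ja x≡ja
  ... | tri< x<ja _ _ with position ia≤x (<⇒≤ x<ja)
  ...   | at-left refl = part-a (InRange-i a wfa) (trans (level-i c) (sym (level-i a)))
  ...   | inside ia<x _ = part-a (ia≤x , <⇒≤ x<ja) (level-c-a x ia<x x<ja)
  ...   | at-right x≡ja = ⊥-elim (<⇒≢ x<ja x≡ja)
  part x (ia≤x , x≤jb) | tri> _ _ ja<x with position (subst (_≤ x) ja≡ib (<⇒≤ ja<x)) x≤jb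
  ...   | at-left x≡ib = ⊥-elim (<⇒≢ ja<x (sym (trans x≡ib (sym ja≡ib))))
  ...   | inside ib<x x<jb = part-b (<⇒≤ ib<x , x≤jb) (level-c-b x ib<x x<jb)
  ...   | at-right refl = part-b (InRange-j b wfb) (trans (level-j c wfc) (sym (level-j b wfb)))

  c-compatible-a : Compatible′ c a
  c-compatible-a = ¬np , λ x _ c>a _ → c≯a x c>a
    where
    ¬np : ¬ NonPointed c a
    ¬np (inj₁ ia≡ja) = <⇒≢ (proj₁ wfa) ia≡ja
    ¬np (inj₂ ia≡jb) = <⇒≢ ia<jb ia≡jb
    c≯a : ∀ x → ¬ Above c a x
    c≯a x (_ , (ia≤x , x≤ja) , a<c) with position ia≤x x≤ja
    ... | at-left refl = <ˡ-irrefl (<ˡ-cast (sym (level-i a)) (sym (level-i c)) a<c)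
    ... | inside ia<x x<ja = <ˡ-irrefl (<ˡ-cast refl (sym (level-c-a x ia<x x<ja)) a<c)
    ... | at-right refl = ≮below level-c-ja a<c

  c-compatible-b : Compatible′ c b
  c-compatible-b = ¬np , λ x _ c>b _ → c≯b x c>b
    where
    ¬np : ¬ NonPointed c b
    ¬np (inj₁ ia≡jb) = <⇒≢ ia<jb ia≡jb
    ¬np (inj₂ ib≡jb) = <⇒≢ (proj₁ wfb) ib≡jb
    c≯b : ∀ x → ¬ Above c b x
    c≯b x (_ , (ib≤x , x≤jb) , b<c) with position ib≤x x≤jb
    ... | at-left refl = ≮below (subst (λ t → level c t ≡ below) ja≡ib level-c-ja) b<c
    ... | inside ib<x x<jb = <ˡ-irrefl (<ˡ-cast refl (sym (level-c-b x ib<x x<jb)) b<c)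
    ... | at-right refl = <ˡ-irrefl (<ˡ-cast (sym (level-j b wfb)) (sym (level-j c wfc)) b<c)

  c-inherits : Inherits a b c
  c-inherits δ wfδ (¬np-a , a-cr) (¬np-b , b-cr) = ¬np , ¬cr
    where
    ¬np : ¬ NonPointed δ c
    ¬np (inj₁ iδ≡jb) = ¬np-b (inj₁ iδ≡jb)
    ¬np (inj₂ ia≡jδ) = ¬np-a (inj₂ ia≡jδ)
    ¬cr : ∀ x y → Above δ c x → Above c δ y → ⊥
    ¬cr x y (in-δx , in-cx , c<δ) (in-cy , in-δy , δ<c) with part x in-cx | part y in-cy
    ... | _ | part-ja refl = ≮below level-c-ja δ<c
    ... | part-a in-a e | part-a in-a′ e′ =
          a-cr x y (in-δx , in-a , <ˡ-cast (sym e) refl c<δ) (in-a′ , in-δy , <ˡ-cast refl (sym e′) δ<c)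
    ... | part-b in-b e | part-b in-b′ e′ =
          b-cr x y (in-δx , in-b , <ˡ-cast (sym e) refl c<δ) (in-b′ , in-δy , <ˡ-cast refl (sym e′) δ<c)
    ... | part-ja refl | part-a in-a′ e′ with at-ja δ wfδ ¬np-a ¬np-b in-δx
    ...   | inj₁ (a>δ , _) = ≮below (<through⇒below a-through-ja (proj₂ (proj₂ a>δ))) c<δ
    ...   | inj₂ (δ>a , _) = a-cr (j a) y δ>a (in-a′ , in-δy , <ˡ-cast refl (sym e′) δ<c)
    ¬cr x y (in-δx , in-cx , c<δ) (in-cy , in-δy , δ<c) | part-ja refl | part-b in-b′ e′ with at-ja δ wfδ ¬np-a ¬np-b in-δx
    ...   | inj₁ (a>δ , _) = ≮below (<through⇒below a-through-ja (proj₂ (proj₂ a>δ))) c<δ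
    ...   | inj₂ (_ , δ>b) = b-cr (j a) y δ>b (in-b′ , in-δy , <ˡ-cast refl (sym e′) δ<c)
    ¬cr x y (in-δx , in-cx , c<δ) (in-cy , in-δy , δ<c) | part-a in-a e | part-b in-b′ e′
      with at-ja δ wfδ ¬np-a ¬np-b (InRange-between δ in-δx in-δy (proj₂ in-a) (≤-trans (≤-reflexive ja≡ib) (proj₁ in-b′)))
    ...   | inj₁ (a>δ , _) = a-cr x (j a) (in-δx , in-a , <ˡ-cast (sym e) refl c<δ) a>δ
    ...   | inj₂ (_ , δ>b) = b-cr (j a) y δ>b (in-b′ , in-δy , <ˡ-cast refl (sym e′) δ<c)
    ¬cr x y (in-δx , in-cx , c<δ) (in-cy , in-δy , δ<c) | part-b in-b e | part-a in-a′ e′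
      with at-ja δ wfδ ¬np-a ¬np-b (InRange-between δ in-δy in-δx (proj₂ in-a′) (≤-trans (≤-reflexive ja≡ib) (proj₁ in-b)))
    ...   | inj₁ (_ , b>δ) = b-cr x (j a) (in-δx , in-b , <ˡ-cast (sym e) refl c<δ) b>δ
    ...   | inj₂ (δ>a , _) = a-cr (j a) y δ>a (in-a′ , in-δy , <ˡ-cast refl (sym e′) δ<c)

  c-survives : SurvivesFlip a b c
  c-survives = record { compatible-a = c-compatible-a ; compatible-b = c-compatible-b ; inherits = c-inherits }

signedIndicator : ℕ → Arc → ℕ → ℚ
signedIndicator n α c = ind (inPlus n α c) -ℚ ind (inMinus n α c)

-- The parts of 1_{α⁺} − 1_{α⁻} contributed by the endpoints i = x and j = x (at the
-- coordinates 2x − 1 and 2x), which vanish at the external points 0 and n + 1.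
start : ℕ → ℕ → ℚ
start x c = ind ((c + 1 ≡ᵇ 2 * x) ∧ not (x ≡ᵇ 0)) -ℚ ind ((c ≡ᵇ 2 * x) ∧ not (x ≡ᵇ 0))

finish : ℕ → ℕ → ℕ → ℚ
finish n x c = ind ((c ≡ᵇ 2 * x) ∧ not (x ≡ᵇ suc n)) -ℚ ind ((c + 1 ≡ᵇ 2 * x) ∧ not (x ≡ᵇ suc n))

height : Level → ℚ
height below   = -ℚ 1ℚ
height through = 0ℚ
height above   = 1ℚ

private
  ind-∨ : ∀ p q → (T p → q ≡ false) → ind (p ∨ q) ≡ ind p +ℚ ind q
  ind-∨ false q _ = sym (ℚ.+-identityˡ (ind q))
  ind-∨ true  q q≡false rewrite q≡false _ = refl

  ≡ᵇ∧⇒≡ : ∀ m n {g} → T ((m ≡ᵇ n) ∧ g) → m ≡ n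
  ≡ᵇ∧⇒≡ m n t = ≡ᵇ⇒≡ m n (proj₁ (Equivalence.to T-∧ t))

  ≢⇒≡ᵇ∧≡false : ∀ {m n} g → m ≢ n → (m ≡ᵇ n) ∧ g ≡ false
  ≢⇒≡ᵇ∧≡false {m} {n} g m≢n rewrite dec-false (m ≟ n) m≢n = refl

  double/2 : ∀ x → (2 * x) ℕ./ 2 ≡ x
  double/2 x = trans (/-congˡ (*-comm 2 x)) (m*n/n≡m x 2)

  double+1/2 : ∀ x → (2 * x + 1) ℕ./ 2 ≡ x
  double+1/2 x = begin
    (2 * x + 1) ℕ./ 2        ≡⟨ +-distrib-/-∣ˡ 1 (divides x (*-comm 2 x)) ⟩
    (2 * x) ℕ./ 2 + 1 ℕ./ 2  ≡⟨ cong (_+ 0) (double/2 x) ⟩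
    x + 0                    ≡⟨ +-identityʳ x ⟩
    x                        ∎

  isA-through : ∀ γ x → level γ x ≡ through → isA γ x ≡ false
  isA-through γ x e = trans (isA≡isAbove γ x) (cong isAbove e)

  isB-through : ∀ γ x → level γ x ≡ through → isB γ x ≡ false
  isB-through γ x e = trans (isB≡isBelow γ x) (cong isBelow e)

  ind-isAbove-isBelow : ∀ u → ind (isAbove u) -ℚ ind (isBelow u) ≡ height u
  ind-isAbove-isBelow below   = refl
  ind-isAbove-isBelow through = refl
  ind-isAbove-isBelow above   = refl

  exchange-starts : ∀ p q r s u v u′ v′ → u +ℚ v ≡ u′ +ℚ v′
           → ((p +ℚ q) +ℚ u) +ℚ ((r +ℚ s) +ℚ v) ≡ ((r +ℚ q) +ℚ u′) +ℚ ((p +ℚ s) +ℚ v′)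
  exchange-starts p q r s u v u′ v′ e = begin
    ((p +ℚ q) +ℚ u) +ℚ ((r +ℚ s) +ℚ v)     ≡⟨ solve 6 (λ p q r s u v → ((p :+ q) :+ u) :+ ((r :+ s) :+ v)
                                                                  := ((p :+ q) :+ (r :+ s)) :+ (u :+ v)) refl p q r s u v ⟩
    ((p +ℚ q) +ℚ (r +ℚ s)) +ℚ (u +ℚ v)     ≡⟨ cong (((p +ℚ q) +ℚ (r +ℚ s)) +ℚ_) e ⟩
    ((p +ℚ q) +ℚ (r +ℚ s)) +ℚ (u′ +ℚ v′)   ≡⟨ solve 6 (λ p q r s u v → ((p :+ q) :+ (r :+ s)) :+ (u :+ v)
                                                                  := ((r :+ q) :+ u) :+ ((p :+ s) :+ v)) refl p q r s u′ v′ ⟩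
    ((r +ℚ q) +ℚ u′) +ℚ ((p +ℚ s) +ℚ v′)   ∎

  merge-joint : ∀ p q r s u v u′ v′ → q +ℚ r ≡ 0ℚ → u′ +ℚ v′ ≡ (u +ℚ v) +ℚ (u +ℚ v)
       → ((p +ℚ s) +ℚ u′) +ℚ ((p +ℚ s) +ℚ v′)
         ≡ (((p +ℚ q) +ℚ u) +ℚ ((r +ℚ s) +ℚ v)) +ℚ (((p +ℚ q) +ℚ u) +ℚ ((r +ℚ s) +ℚ v))
  merge-joint p q r s u v u′ v′ q+r≡0 e = begin
    ((p +ℚ s) +ℚ u′) +ℚ ((p +ℚ s) +ℚ v′)
      ≡⟨ solve 4 (λ p s u′ v′ → ((p :+ s) :+ u′) :+ ((p :+ s) :+ v′) := ((p :+ s) :+ (p :+ s)) :+ (u′ :+ v′))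
                 refl p s u′ v′ ⟩
    ((p +ℚ s) +ℚ (p +ℚ s)) +ℚ (u′ +ℚ v′)
      ≡⟨ cong (((p +ℚ s) +ℚ (p +ℚ s)) +ℚ_) e ⟩
    ((p +ℚ s) +ℚ (p +ℚ s)) +ℚ ((u +ℚ v) +ℚ (u +ℚ v))
      ≡⟨ solve 6 (λ p q r s u v → ((p :+ s) :+ (p :+ s)) :+ ((u :+ v) :+ (u :+ v))
                   := ((((p :+ q) :+ u) :+ ((r :+ s) :+ v)) :+ (((p :+ q) :+ u) :+ ((r :+ s) :+ v)))
                      :- ((q :+ r) :+ (q :+ r)))
                 refl p q r s u v ⟩
    (W +ℚ W) -ℚ ((q +ℚ r) +ℚ (q +ℚ r))
      ≡⟨ cong (λ z → (W +ℚ W) -ℚ (z +ℚ z)) q+r≡0 ⟩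
    (W +ℚ W) -ℚ (0ℚ +ℚ 0ℚ)
      ≡⟨ ℚ.+-identityʳ (W +ℚ W) ⟩
    W +ℚ W ∎
    where
    W : ℚ
    W = ((p +ℚ q) +ℚ u) +ℚ ((r +ℚ s) +ℚ v)

  module Coordinate (n : ℕ) (γ : Arc) (wf : WellFormed γ) (c : ℕ) where

    X : ℕ
    X = (c + 1) ℕ./ 2

    P₁ P₂ Q₁ Q₂ : Bool
    P₁ = (c + 1 ≡ᵇ 2 * i γ) ∧ not (i γ ≡ᵇ 0)
    P₂ = (c ≡ᵇ 2 * j γ) ∧ not (j γ ≡ᵇ suc n)
    Q₁ = (c ≡ᵇ 2 * i γ) ∧ not (i γ ≡ᵇ 0)
    Q₂ = (c + 1 ≡ᵇ 2 * j γ) ∧ not (j γ ≡ᵇ suc n)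

    X≡-odd : ∀ {x} → c + 1 ≡ 2 * x → X ≡ x
    X≡-odd {x} e = trans (/-congˡ e) (double/2 x)

    X≡-even : ∀ {x} → c ≡ 2 * x → X ≡ x
    X≡-even {x} e = trans (/-congˡ (cong (_+ 1) e)) (double+1/2 x)

    through-at-i : X ≡ i γ → level γ X ≡ through
    through-at-i e = subst (λ t → level γ t ≡ through) (sym e) (level-i γ)

    through-at-j : X ≡ j γ → level γ X ≡ through
    through-at-j e = subst (λ t → level γ t ≡ through) (sym e) (level-j γ wf)

    ind-inPlus : ind (inPlus n γ c) ≡ ind P₁ +ℚ (ind P₂ +ℚ ind (isA γ X))
    ind-inPlus = trans (ind-∨ P₁ _ P₁-alone) (cong (ind P₁ +ℚ_) (ind-∨ P₂ _ P₂-alone))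
      where
      P₁-alone : T P₁ → P₂ ∨ isA γ X ≡ false
      P₁-alone t = cong₂ _∨_ (≢⇒≡ᵇ∧≡false (not (j γ ≡ᵇ suc n)) c≢2j) (isA-through γ X (through-at-i (X≡-odd c+1≡2i)))
        where
        c+1≡2i : c + 1 ≡ 2 * i γ
        c+1≡2i = ≡ᵇ∧⇒≡ (c + 1) (2 * i γ) t
        c≢2j : c ≢ 2 * j γ
        c≢2j c≡2j = <⇒≱ (*-monoʳ-< 2 (proj₁ wf)) (<⇒≤ (subst₂ _<_ c≡2j c+1≡2i (m<m+n c (s≤s z≤n))))
      P₂-alone : T P₂ → isA γ X ≡ false
      P₂-alone t = isA-through γ X (through-at-j (X≡-even (≡ᵇ∧⇒≡ c (2 * j γ) t)))

    ind-inMinus : ind (inMinus n γ c) ≡ ind Q₁ +ℚ (ind Q₂ +ℚ ind (isB γ X))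
    ind-inMinus = trans (ind-∨ Q₁ _ Q₁-alone) (cong (ind Q₁ +ℚ_) (ind-∨ Q₂ _ Q₂-alone))
      where
      Q₁-alone : T Q₁ → Q₂ ∨ isB γ X ≡ false
      Q₁-alone t = cong₂ _∨_ (≢⇒≡ᵇ∧≡false (not (j γ ≡ᵇ suc n)) c+1≢2j) (isB-through γ X (through-at-i (X≡-even c≡2i)))
        where
        c≡2i : c ≡ 2 * i γ
        c≡2i = ≡ᵇ∧⇒≡ c (2 * i γ) t
        c+1≢2j : c + 1 ≢ 2 * j γ
        c+1≢2j e = even≢odd (j γ) (i γ) (sym (trans (trans (cong suc (sym c≡2i)) (+-comm 1 c)) e))
      Q₂-alone : T Q₂ → isB γ X ≡ false
      Q₂-alone t = isB-through γ X (through-at-j (X≡-odd (≡ᵇ∧⇒≡ (c + 1) (2 * j γ) t)))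

-- coordinates 2x − 1 and 2x both belong to the point x = ⌊(c + 1) / 2⌋
signedIndicator-split : ∀ n γ → WellFormed γ → ∀ c
  → signedIndicator n γ c ≡ (start (i γ) c +ℚ finish n (j γ) c) +ℚ height (level γ ((c + 1) ℕ./ 2))
signedIndicator-split n γ wf c = begin
  ind (inPlus n γ c) -ℚ ind (inMinus n γ c)
    ≡⟨ cong₂ _-ℚ_ ind-inPlus ind-inMinus ⟩
  (ind P₁ +ℚ (ind P₂ +ℚ ind (isA γ X))) -ℚ (ind Q₁ +ℚ (ind Q₂ +ℚ ind (isB γ X)))
    ≡⟨ regroup (ind P₁) (ind P₂) (ind (isA γ X)) (ind Q₁) (ind Q₂) (ind (isB γ X)) ⟩
  (start (i γ) c +ℚ finish n (j γ) c) +ℚ (ind (isA γ X) -ℚ ind (isB γ X))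
    ≡⟨ cong ((start (i γ) c +ℚ finish n (j γ) c) +ℚ_)
            (trans (cong₂ (λ p q → ind p -ℚ ind q) (isA≡isAbove γ X) (isB≡isBelow γ X)) (ind-isAbove-isBelow (level γ X))) ⟩
  (start (i γ) c +ℚ finish n (j γ) c) +ℚ height (level γ X) ∎
  where
  open Coordinate n γ wf c
  regroup : ∀ p₁ p₂ u q₁ q₂ w → (p₁ +ℚ (p₂ +ℚ u)) -ℚ (q₁ +ℚ (q₂ +ℚ w)) ≡ ((p₁ -ℚ q₁) +ℚ (p₂ -ℚ q₂)) +ℚ (u -ℚ w)
  regroup = solve 6 (λ p₁ p₂ u q₁ q₂ w → (p₁ :+ (p₂ :+ u)) :- (q₁ :+ (q₂ :+ w))
                                      := ((p₁ :- q₁) :+ (p₂ :- q₂)) :+ (u :- w)) refl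

finish+start≡0 : ∀ n x c → 0 < x → x ≤ n → finish n x c +ℚ start x c ≡ 0ℚ
finish+start≡0 n x c 0<x x≤n
  rewrite dec-false (x ≟ 0) (>⇒≢ 0<x) | dec-false (x ≟ suc n) (<⇒≢ (s≤s x≤n)) =
  cancel (ind ((c ≡ᵇ 2 * x) ∧ true)) (ind ((c + 1 ≡ᵇ 2 * x) ∧ true))
  where
  cancel : ∀ p q → (p -ℚ q) +ℚ (q -ℚ p) ≡ 0ℚ
  cancel = solve 2 (λ p q → (p :- q) :+ (q :- p) := con 0ℚ) refl

sumTo-cong : ∀ m {x y : ℕ → ℚ} → (∀ c → x c ≡ y c) → sumTo m x ≡ sumTo m y
sumTo-cong zero    eq = refl
sumTo-cong (suc m) eq = cong₂ _+ℚ_ (sumTo-cong m eq) (eq (suc m))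

sumTo-⊕ : ∀ m x y → sumTo m (x ⊕ y) ≡ sumTo m x +ℚ sumTo m y
sumTo-⊕ zero    x y = refl
sumTo-⊕ (suc m) x y = begin
  sumTo m (x ⊕ y) +ℚ (x (suc m) +ℚ y (suc m))               ≡⟨ cong (_+ℚ (x (suc m) +ℚ y (suc m))) (sumTo-⊕ m x y) ⟩
  (sumTo m x +ℚ sumTo m y) +ℚ (x (suc m) +ℚ y (suc m))      ≡⟨ +-interchange (sumTo m x) (sumTo m y) (x (suc m)) (y (suc m)) ⟩
  (sumTo m x +ℚ x (suc m)) +ℚ (sumTo m y +ℚ y (suc m))      ∎

proj-cong : ∀ n {x y} → (∀ c → x c ≡ y c) → ∀ c → proj n x c ≡ proj n y c
proj-cong n eq c = cong₂ (λ p s → p -ℚ s *ℚ inv2n n) (eq c) (sumTo-cong (2 * n) eq)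

proj-⊕ : ∀ n x y c → proj n (x ⊕ y) c ≡ proj n x c +ℚ proj n y c
proj-⊕ n x y c = begin
  (x c +ℚ y c) -ℚ sumTo (2 * n) (x ⊕ y) *ℚ K                   ≡⟨ cong (λ s → (x c +ℚ y c) -ℚ s *ℚ K) (sumTo-⊕ (2 * n) x y) ⟩
  (x c +ℚ y c) -ℚ (sumTo (2 * n) x +ℚ sumTo (2 * n) y) *ℚ K    ≡⟨ distribute (x c) (y c) (sumTo (2 * n) x) (sumTo (2 * n) y) K ⟩
  (x c -ℚ sumTo (2 * n) x *ℚ K) +ℚ (y c -ℚ sumTo (2 * n) y *ℚ K) ∎
  where
  K : ℚ
  K = inv2n n
  distribute : ∀ p q s t k → (p +ℚ q) -ℚ (s +ℚ t) *ℚ k ≡ (p -ℚ s *ℚ k) +ℚ (q -ℚ t *ℚ k)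
  distribute = solve 5 (λ p q s t k → (p :+ q) :- (s :+ t) :* k := (p :- s :* k) :+ (q :- t :* k)) refl

proj-⊕-cong : ∀ n {x y x′ y′} → (∀ c → x c +ℚ y c ≡ x′ c +ℚ y′ c)
            → (proj n x ⊕ proj n y) ≈[ n ] (proj n x′ ⊕ proj n y′)
proj-⊕-cong n {x} {y} {x′} {y′} eq c _ _ = begin
  proj n x c +ℚ proj n y c      ≡⟨ proj-⊕ n x y c ⟨
  proj n (x ⊕ y) c              ≡⟨ proj-cong n eq c ⟩
  proj n (x′ ⊕ y′) c            ≡⟨ proj-⊕ n x′ y′ c ⟩
  proj n x′ c +ℚ proj n y′ c    ∎

proj-⊕-cong-double : ∀ n {x y x′ y′} → (∀ c → x′ c +ℚ y′ c ≡ (x c +ℚ y c) +ℚ (x c +ℚ y c))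
                   → (proj n x ⊕ proj n y) ≈[ n ] half (proj n x′ ⊕ proj n y′)
proj-⊕-cong-double n {x} {y} {x′} {y′} eq c _ _ = begin
  proj n x c +ℚ proj n y c                              ≡⟨ proj-⊕ n x y c ⟨
  proj n (x ⊕ y) c                                      ≡⟨ halve (proj n (x ⊕ y) c) ⟩
  (proj n (x ⊕ y) c +ℚ proj n (x ⊕ y) c) *ℚ ½           ≡⟨ cong (_*ℚ ½) (proj-⊕ n (x ⊕ y) (x ⊕ y) c) ⟨
  proj n ((x ⊕ y) ⊕ (x ⊕ y)) c *ℚ ½                     ≡⟨ cong (_*ℚ ½) (proj-cong n (λ c → sym (eq c)) c) ⟩
  proj n (x′ ⊕ y′) c *ℚ ½                               ≡⟨ cong (_*ℚ ½) (proj-⊕ n x′ y′ c) ⟩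
  (proj n x′ c +ℚ proj n y′ c) *ℚ ½                     ∎
  where
  ½ : ℚ
  ½ = + 1 / 2
  halve : ∀ p → p ≡ (p +ℚ p) *ℚ ½
  halve = solve 1 (λ p → p := (p :+ p) :* con ½) refl

module CrossingArcs (a b : Arc) (wfa : WellFormed a) (wfb : WellFormed b) {k ℓ : ℕ} (k<ℓ : k < ℓ)
                    (a>b : Above a b k) (b>a : Above b a ℓ) where

  ib<ja : i b < j a
  ib<ja = proj₁ (crossing-overlap a b k<ℓ a>b b>a)

  ia<jb : i a < j b
  ia<jb = proj₂ (crossing-overlap a b k<ℓ a>b b>a)

  β β′ : Arc
  β  = β₂ a b
  β′ = β₂' a b

  β-wellFormed : WellFormed β
  β-wellFormed = mkArc-wellFormed (i b) (j a) (λ k → not (isB a k ∨ isB b k)) ib<ja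

  β′-wellFormed : WellFormed β′
  β′-wellFormed = mkArc-wellFormed (i a) (j b) (λ k → isA a k ∨ isA b k) ia<jb

  level-β : ∀ x → i b < x → x < j a → level β x ≡ lower (level a x) (level b x)
  level-β x ib<x x<ja = trans (level-mkArc (i b) (j a) (λ k → not (isB a k ∨ isB b k)) x ib<x x<ja)
                              (cong₂ (λ p q → levelOf (just (not (p ∨ q)))) (isB≡isBelow a x) (isB≡isBelow b x))

  level-β′ : ∀ x → i a < x → x < j b → level β′ x ≡ upper (level a x) (level b x)
  level-β′ x ia<x x<jb = trans (level-mkArc (i a) (j b) (λ k → isA a k ∨ isA b k) x ia<x x<jb)
                               (cong₂ (λ p q → levelOf (just (p ∨ q))) (isA≡isAbove a x) (isA≡isAbove b x))

  private
    β-follows-a : ∀ X → i a < X → X < j a → i b < X → level b X ≡ through → level β X ≡ level a X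
    β-follows-a X ia<X X<ja ib<X b-through = begin
      level β X                        ≡⟨ level-β X ib<X X<ja ⟩
      lower (level a X) (level b X)    ≡⟨ cong (lower (level a X)) b-through ⟩
      lower (level a X) through        ≡⟨ lower-through (level a X) (level-interior a X wfa ia<X X<ja) ⟩
      level a X                        ∎

    β-follows-b : ∀ X → i b < X → X < j b → X < j a → level a X ≡ through → level β X ≡ level b X
    β-follows-b X ib<X X<jb X<ja a-through = begin
      level β X                        ≡⟨ level-β X ib<X X<ja ⟩
      lower (level a X) (level b X)    ≡⟨ cong (λ u → lower u (level b X)) a-through ⟩
      lower through (level b X)        ≡⟨ through-lower (level b X) (level-interior b X wfb ib<X X<jb) ⟩
      level b X                        ∎

    β′-follows-a : ∀ X → i a < X → X < j a → X < j b → level b X ≡ through → level β′ X ≡ level a X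
    β′-follows-a X ia<X X<ja X<jb b-through = begin
      level β′ X                       ≡⟨ level-β′ X ia<X X<jb ⟩
      upper (level a X) (level b X)    ≡⟨ cong (upper (level a X)) b-through ⟩
      upper (level a X) through        ≡⟨ upper-through (level a X) (level-interior a X wfa ia<X X<ja) ⟩
      level a X                        ∎

    β′-follows-b : ∀ X → i b < X → X < j b → i a < X → level a X ≡ through → level β′ X ≡ level b X
    β′-follows-b X ib<X X<jb ia<X a-through = begin
      level β′ X                       ≡⟨ level-β′ X ia<X X<jb ⟩
      upper (level a X) (level b X)    ≡⟨ cong (λ u → upper u (level b X)) a-through ⟩
      upper through (level b X)        ≡⟨ through-upper (level b X) (level-interior b X wfb ib<X X<jb) ⟩
      level b X                        ∎

  levels-swapped : ∀ X → (level β X ≡ level a X × level β′ X ≡ level b X) ⊎ (level β X ≡ level b X × level β′ X ≡ level a X)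
  levels-swapped X with i a <? X | X <? j a | i b <? X | X <? j b
  ... | yes ia<X | yes X<ja | yes ib<X | yes X<jb
      with lower-upper-swap (level a X) (level b X) (level-interior a X wfa ia<X X<ja) (level-interior b X wfb ib<X X<jb)
  ...   | inj₁ (e , e′) = inj₁ (trans (level-β X ib<X X<ja) e , trans (level-β′ X ia<X X<jb) e′)
  ...   | inj₂ (e , e′) = inj₂ (trans (level-β X ib<X X<ja) e , trans (level-β′ X ia<X X<jb) e′)
  levels-swapped X | yes ia<X | yes X<ja | no ib≮X | _ =
    inj₂ (trans (level-≤i β X (≮⇒≥ ib≮X)) (sym (level-≤i b X (≮⇒≥ ib≮X))) ,
          β′-follows-a X ia<X X<ja (≤-<-trans (≮⇒≥ ib≮X) (proj₁ wfb)) (level-≤i b X (≮⇒≥ ib≮X)))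
  levels-swapped X | yes ia<X | yes X<ja | yes ib<X | no X≮jb =
    inj₁ (β-follows-a X ia<X X<ja ib<X (level-≥j b X wfb (≮⇒≥ X≮jb)) ,
          trans (level-≥j β′ X β′-wellFormed (≮⇒≥ X≮jb)) (sym (level-≥j b X wfb (≮⇒≥ X≮jb))))
  levels-swapped X | no ia≮X | _ | yes ib<X | yes X<jb =
    inj₂ (β-follows-b X ib<X X<jb (≤-<-trans (≮⇒≥ ia≮X) (proj₁ wfa)) (level-≤i a X (≮⇒≥ ia≮X)) ,
          trans (level-≤i β′ X (≮⇒≥ ia≮X)) (sym (level-≤i a X (≮⇒≥ ia≮X))))
  levels-swapped X | yes ia<X | no X≮ja | yes ib<X | yes X<jb =
    inj₁ (trans (level-≥j β X β-wellFormed (≮⇒≥ X≮ja)) (sym (level-≥j a X wfa (≮⇒≥ X≮ja))) ,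
          β′-follows-b X ib<X X<jb ia<X (level-≥j a X wfa (≮⇒≥ X≮ja)))
  levels-swapped X | no ia≮X | _ | no ib≮X | _ =
    inj₁ (trans (level-≤i β X (≮⇒≥ ib≮X)) (sym (level-≤i a X (≮⇒≥ ia≮X))) ,
          trans (level-≤i β′ X (≮⇒≥ ia≮X)) (sym (level-≤i b X (≮⇒≥ ib≮X))))
  levels-swapped X | yes _ | no X≮ja | _ | no X≮jb =
    inj₁ (trans (level-≥j β X β-wellFormed (≮⇒≥ X≮ja)) (sym (level-≥j a X wfa (≮⇒≥ X≮ja))) ,
          trans (level-≥j β′ X β′-wellFormed (≮⇒≥ X≮jb)) (sym (level-≥j b X wfb (≮⇒≥ X≮jb))))
  levels-swapped X | no ia≮X | _ | yes ib<X | no X≮jb = ⊥-elim (<⇒≱ ia<jb (≤-trans (≮⇒≥ X≮jb) (≮⇒≥ ia≮X)))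
  levels-swapped X | yes _ | no X≮ja | no ib≮X | _ = ⊥-elim (<⇒≱ ib<ja (≤-trans (≮⇒≥ X≮ja) (≮⇒≥ ib≮X)))

  heights-swapped : ∀ X → height (level a X) +ℚ height (level b X) ≡ height (level β X) +ℚ height (level β′ X)
  heights-swapped X with levels-swapped X
  ... | inj₁ (e , e′) = sym (cong₂ (λ u w → height u +ℚ height w) e e′)
  ... | inj₂ (e , e′) = trans (ℚ.+-comm (height (level a X)) (height (level b X)))
                              (sym (cong₂ (λ u w → height u +ℚ height w) e e′))

  signedIndicator-swapped : ∀ n c → signedIndicator n a c +ℚ signedIndicator n b c
                                  ≡ signedIndicator n β c +ℚ signedIndicator n β′ c
  signedIndicator-swapped n c = begin
    signedIndicator n a c +ℚ signedIndicator n b c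
      ≡⟨ cong₂ _+ℚ_ (signedIndicator-split n a wfa c) (signedIndicator-split n b wfb c) ⟩
    ((start (i a) c +ℚ finish n (j a) c) +ℚ height (level a X)) +ℚ ((start (i b) c +ℚ finish n (j b) c) +ℚ height (level b X))
      ≡⟨ exchange-starts (start (i a) c) (finish n (j a) c) (start (i b) c) (finish n (j b) c) _ _ _ _ (heights-swapped X) ⟩
    ((start (i b) c +ℚ finish n (j a) c) +ℚ height (level β X)) +ℚ ((start (i a) c +ℚ finish n (j b) c) +ℚ height (level β′ X))
      ≡⟨ cong₂ _+ℚ_ (signedIndicator-split n β β-wellFormed c) (signedIndicator-split n β′ β′-wellFormed c) ⟨
    signedIndicator n β c +ℚ signedIndicator n β′ c ∎
    where
    X : ℕ
    X = (c + 1) ℕ./ 2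
  g-swapped : ∀ n → (g n a ⊕ g n b) ≈[ n ] (g n β ⊕ g n β′)
  g-swapped n = proj-⊕-cong n {signedIndicator n a} {signedIndicator n b} {signedIndicator n β} {signedIndicator n β′}
                             (signedIndicator-swapped n)

  module _ (single : ∀ x y → x < y → Above b a x → Above a b y → ⊥) where

    β-survives : SurvivesFlip a b β
    β-survives = CrossingCore.c-survives a b wfa wfb k<ℓ a>b b>a single (side β) β-wellFormed level-β

    β′-survives : SurvivesFlip a b β′
    β′-survives = SurvivesFlip-unflip (SurvivesFlip-swap
      (CrossingCore.c-survives (flipArc b) (flipArc a) (WellFormed-flip b wfb) (WellFormed-flip a wfa) k<ℓ
        (Above-flip a b k a>b) (Above-flip b a ℓ b>a) single′
        (side (flipArc β′)) (WellFormed-flip β′ β′-wellFormed) level-flipped))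
      where
      single′ : ∀ x y → x < y → Above (flipArc a) (flipArc b) x → Above (flipArc b) (flipArc a) y → ⊥
      single′ x y x<y b>a′ a>b′ = single x y x<y (Above-unflip b a x b>a′) (Above-unflip a b y a>b′)
      level-flipped : ∀ x → i a < x → x < j b → level (flipArc β′) x ≡ lower (level (flipArc b) x) (level (flipArc a) x)
      level-flipped x ia<x x<jb = begin
        level (flipArc β′) x                                  ≡⟨ level-flip β′ x ⟩
        negate (level β′ x)                                   ≡⟨ cong negate (level-β′ x ia<x x<jb) ⟩
        negate (upper (level a x) (level b x))                ≡⟨ negate-upper (level a x) (level b x) ⟩
        lower (negate (level b x)) (negate (level a x))       ≡⟨ cong₂ lower (level-flip b x) (level-flip a x) ⟨
        lower (level (flipArc b) x) (level (flipArc a) x)     ∎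

module NonPointedArcs (a b : Arc) (wfa : WellFormed a) (wfb : WellFormed b) (ja≡ib : j a ≡ i b) where

  β β′ : Arc
  β  = β₁ a b
  β′ = β₁' a b

  ja<jb : j a < j b
  ja<jb = joined-ja<jb a b wfb ja≡ib

  ia<jb : i a < j b
  ia<jb = <-trans (proj₁ wfa) ja<jb

  β-wellFormed : WellFormed β
  β-wellFormed = mkArc-wellFormed (i a) (j b) (λ k → isA a k ∨ isA b k) ia<jb

  β′-wellFormed : WellFormed β′
  β′-wellFormed = mkArc-wellFormed (i a) (j b) (λ k → isA a k ∨ isA b k ∨ (k ≡ᵇ j a)) ia<jb

  level-β : ∀ x → i a < x → x < j b → level β x ≡ upper (level a x) (level b x)
  level-β x ia<x x<jb = trans (level-mkArc (i a) (j b) (λ k → isA a k ∨ isA b k) x ia<x x<jb)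
                              (cong₂ (λ p q → levelOf (just (p ∨ q))) (isA≡isAbove a x) (isA≡isAbove b x))

  level-β′ : ∀ x → i a < x → x < j b
           → level β′ x ≡ levelOf (just (isAbove (level a x) ∨ isAbove (level b x) ∨ (x ≡ᵇ j a)))
  level-β′ x ia<x x<jb = trans (level-mkArc (i a) (j b) (λ k → isA a k ∨ isA b k ∨ (k ≡ᵇ j a)) x ia<x x<jb)
                               (cong₂ (λ p q → levelOf (just (p ∨ q ∨ (x ≡ᵇ j a)))) (isA≡isAbove a x) (isA≡isAbove b x))

  ib<⇒ja< : ∀ {x} → i b < x → j a < x
  ib<⇒ja< = subst (_< _) (sym ja≡ib)

  ja<⇒ib< : ∀ {x} → j a < x → i b < x
  ja<⇒ib< = subst (_< _) ja≡ib

  b-through-before : ∀ x → x ≤ j a → level b x ≡ through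
  b-through-before x x≤ja = level-≤i b x (subst (x ≤_) ja≡ib x≤ja)

  a-through-after : ∀ x → j a ≤ x → level a x ≡ through
  a-through-after x ja≤x = level-≥j a x wfa ja≤x

  level-β-a : ∀ x → i a < x → x < j a → level β x ≡ level a x
  level-β-a x ia<x x<ja rewrite level-β x ia<x (<-trans x<ja ja<jb) | b-through-before x (<⇒≤ x<ja) =
    upper-through (level a x) (level-interior a x wfa ia<x x<ja)

  level-β-ja : level β (j a) ≡ below
  level-β-ja rewrite level-β (j a) (proj₁ wfa) ja<jb | a-through-after (j a) ≤-refl | b-through-before (j a) ≤-refl = refl

  level-β-b : ∀ x → i b < x → x < j b → level β x ≡ level b x
  level-β-b x ib<x x<jb
    rewrite level-β x (<-trans (proj₁ wfa) (ib<⇒ja< ib<x)) x<jb | a-through-after x (<⇒≤ (ib<⇒ja< ib<x)) =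
    through-upper (level b x) (level-interior b x wfb ib<x x<jb)

  level-β′-a : ∀ x → i a < x → x < j a → level β′ x ≡ level a x
  level-β′-a x ia<x x<ja
    rewrite level-β′ x ia<x (<-trans x<ja ja<jb) | b-through-before x (<⇒≤ x<ja) | dec-false (x ≟ j a) (<⇒≢ x<ja) =
    upper-through (level a x) (level-interior a x wfa ia<x x<ja)

  level-β′-ja : level β′ (j a) ≡ above
  level-β′-ja rewrite level-β′ (j a) (proj₁ wfa) ja<jb | a-through-after (j a) ≤-refl | b-through-before (j a) ≤-refl
                    | dec-true (j a ≟ j a) refl = refl

  level-β′-b : ∀ x → i b < x → x < j b → level β′ x ≡ level b x
  level-β′-b x ib<x x<jb
    rewrite level-β′ x (<-trans (proj₁ wfa) (ib<⇒ja< ib<x)) x<jb | a-through-after x (<⇒≤ (ib<⇒ja< ib<x))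
          | dec-false (x ≟ j a) (>⇒≢ (ib<⇒ja< ib<x)) =
    upper-through (level b x) (level-interior b x wfb ib<x x<jb)

  β-survives : SurvivesFlip a b β
  β-survives = NonPointedCore.c-survives a b wfa wfb ja≡ib (side β) β-wellFormed level-β-a level-β-ja level-β-b

  β′-survives : SurvivesFlip a b β′
  β′-survives = SurvivesFlip-unflip
    (NonPointedCore.c-survives (flipArc a) (flipArc b) (WellFormed-flip a wfa) (WellFormed-flip b wfb) ja≡ib
      (side (flipArc β′)) (WellFormed-flip β′ β′-wellFormed) flipped-a flipped-ja flipped-b)
    where
    flipped-a : ∀ x → i a < x → x < j a → level (flipArc β′) x ≡ level (flipArc a) x
    flipped-a x ia<x x<ja = trans (level-flip β′ x) (trans (cong negate (level-β′-a x ia<x x<ja)) (sym (level-flip a x)))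
    flipped-ja : level (flipArc β′) (j a) ≡ below
    flipped-ja = trans (level-flip β′ (j a)) (cong negate level-β′-ja)
    flipped-b : ∀ x → i b < x → x < j b → level (flipArc β′) x ≡ level (flipArc b) x
    flipped-b x ib<x x<jb = trans (level-flip β′ x) (trans (cong negate (level-β′-b x ib<x x<jb)) (sym (level-flip b x)))

  heights-doubled : ∀ X → height (level β X) +ℚ height (level β′ X)
                        ≡ (height (level a X) +ℚ height (level b X)) +ℚ (height (level a X) +ℚ height (level b X))
  heights-doubled X with <-cmp X (j a)
  ... | tri≈ _ refl _
    rewrite level-β-ja | level-β′-ja | a-through-after (j a) ≤-refl | b-through-before (j a) ≤-refl = refl
  ... | tri< X<ja _ _ with i a <? X
  ...   | yes ia<X rewrite level-β-a X ia<X X<ja | level-β′-a X ia<X X<ja | b-through-before X (<⇒≤ X<ja) =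
          solve 1 (λ p → p :+ p := (p :+ con 0ℚ) :+ (p :+ con 0ℚ)) refl (height (level a X))
  ...   | no ia≮X rewrite level-≤i β X (≮⇒≥ ia≮X) | level-≤i β′ X (≮⇒≥ ia≮X) | level-≤i a X (≮⇒≥ ia≮X)
                        | b-through-before X (<⇒≤ X<ja) = refl
  heights-doubled X | tri> _ _ ja<X with X <? j b
  ...   | yes X<jb rewrite level-β-b X (ja<⇒ib< ja<X) X<jb | level-β′-b X (ja<⇒ib< ja<X) X<jb
                         | a-through-after X (<⇒≤ ja<X) =
          solve 1 (λ p → p :+ p := (con 0ℚ :+ p) :+ (con 0ℚ :+ p)) refl (height (level b X))
  ...   | no X≮jb rewrite level-≥j β X β-wellFormed (≮⇒≥ X≮jb) | level-≥j β′ X β′-wellFormed (≮⇒≥ X≮jb)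
                        | a-through-after X (<⇒≤ ja<X) | level-≥j b X wfb (≮⇒≥ X≮jb) = refl

  signedIndicator-doubled : ∀ n → j b ≤ suc n → ∀ c
    → signedIndicator n β c +ℚ signedIndicator n β′ c
      ≡ (signedIndicator n a c +ℚ signedIndicator n b c) +ℚ (signedIndicator n a c +ℚ signedIndicator n b c)
  signedIndicator-doubled n jb≤1+n c = begin
    signedIndicator n β c +ℚ signedIndicator n β′ c
      ≡⟨ cong₂ _+ℚ_ (signedIndicator-split n β β-wellFormed c) (signedIndicator-split n β′ β′-wellFormed c) ⟩
    ((start (i a) c +ℚ finish n (j b) c) +ℚ height (level β X)) +ℚ ((start (i a) c +ℚ finish n (j b) c) +ℚ height (level β′ X))
      ≡⟨ merge-joint (start (i a) c) (finish n (j a) c) (start (i b) c) (finish n (j b) c) _ _ _ _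
                     joint-vanishes (heights-doubled X) ⟩
    (A +ℚ B) +ℚ (A +ℚ B)
      ≡⟨ cong₂ (λ p q → (p +ℚ q) +ℚ (p +ℚ q)) (signedIndicator-split n a wfa c) (signedIndicator-split n b wfb c) ⟨
    (signedIndicator n a c +ℚ signedIndicator n b c) +ℚ (signedIndicator n a c +ℚ signedIndicator n b c) ∎
    where
    X : ℕ
    X = (c + 1) ℕ./ 2
    A B : ℚ
    A = (start (i a) c +ℚ finish n (j a) c) +ℚ height (level a X)
    B = (start (i b) c +ℚ finish n (j b) c) +ℚ height (level b X)
    joint-vanishes : finish n (j a) c +ℚ start (i b) c ≡ 0ℚ
    joint-vanishes = subst (λ t → finish n (j a) c +ℚ start t c ≡ 0ℚ) ja≡ib
                       (finish+start≡0 n (j a) c (≤-<-trans z≤n (proj₁ wfa)) (≤-pred (<-≤-trans ja<jb jb≤1+n)))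

  g-doubled : ∀ n → j b ≤ suc n → (g n a ⊕ g n b) ≈[ n ] half (g n β ⊕ g n β′)
  g-doubled n jb≤1+n = proj-⊕-cong-double n {signedIndicator n a} {signedIndicator n b}
                         {signedIndicator n β} {signedIndicator n β′} (signedIndicator-doubled n jb≤1+n)


module Flip (n : ℕ) (T T′ : ArcSet) (PT : IsWigglyPT n T) (PT′ : IsWigglyPT n T′)
            (a b : Arc) (Ta : T a) (T′b : T′ b)
            (same : ∀ γ → (T γ × γ ≢ a) ⇔ (T′ γ × γ ≢ b)) where

  private
    module L = FlipSide n T T′ PT PT′ a b Ta T′b same
    module R = FlipSide n T′ T PT′ PT b a T′b Ta (λ γ → ⇔-sym (same γ))

  ∈-both : ∀ γ → IsArc n γ → SurvivesFlip a b γ → T γ × T′ γ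
  ∈-both γ arcγ s = L.∈T γ arcγ compatible-a inherits , R.∈T γ arcγ compatible-b (λ δ wfδ δ-b δ-a → inherits δ wfδ δ-a δ-b)
    where open SurvivesFlip s

  -- a crossing back would contain a tight switch, which Cut turns into an arc of T ∩ T′ crossing a or b
  single-crossing : ∀ {k ℓ} → k < ℓ → Above a b k → Above b a ℓ
                  → ∀ x y → x < y → Above b a x → Above a b y → ⊥
  single-crossing {k} {ℓ} k<ℓ a>b-k b>a-ℓ x y x<y b>a-x a>b-y with <-cmp x k
  ... | tri≈ _ refl _ = Above-asym a b x a>b-k b>a-x
  ... | tri< x<k _ _  = R.no-cut b>a-x (TightSwitch-weaken x<k (tightSwitch b a k ℓ k<ℓ a>b-k b>a-ℓ))
  ... | tri> _ _ k<x  = L.no-cut a>b-k (TightSwitch-weaken k<x (tightSwitch a b x y x<y b>a-x a>b-y))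

  non-pointed-flip : j a ≡ i b
    → (T (β₁ a b) × T′ (β₁ a b)) × (T (β₁' a b) × T′ (β₁' a b))
      × ((g n a ⊕ g n b) ≈[ n ] half (g n (β₁ a b) ⊕ g n (β₁' a b)))
  non-pointed-flip ja≡ib =
    ∈-both β (WellFormed⇒IsArc β β-wellFormed jb≤1+n) β-survives ,
    ∈-both β′ (WellFormed⇒IsArc β′ β′-wellFormed jb≤1+n) β′-survives ,
    g-doubled n jb≤1+n
    where
    open NonPointedArcs a b L.wf-a L.wf-b ja≡ib
    jb≤1+n : j b ≤ suc n
    jb≤1+n = proj₁ (proj₂ (IsWigglyPT.valid PT′ b T′b))

  crossing-flip : CrossesNWSE n a b
    → (T (β₂ a b) × T′ (β₂ a b)) × (T (β₂' a b) × T′ (β₂' a b))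
      × ((g n a ⊕ g n b) ≈[ n ] (g n (β₂ a b) ⊕ g n (β₂' a b)))
  crossing-flip (k , ℓ , _ , k<ℓ , _ , k-side , ℓ-side) =
    ∈-both β (WellFormed⇒IsArc β β-wellFormed (proj₁ (proj₂ (IsWigglyPT.valid PT a Ta)))) (β-survives single) ,
    ∈-both β′ (WellFormed⇒IsArc β′ β′-wellFormed (proj₁ (proj₂ (IsWigglyPT.valid PT′ b T′b)))) (β′-survives single) ,
    g-swapped n
    where
    a>b : Above a b k
    a>b = CrossSideAt⇒Above a b k L.wf-a L.wf-b (CrossSideAt-starts a b k k-side)
    b>a : Above b a ℓ
    b>a = CrossSideAt⇒Above b a ℓ L.wf-b L.wf-a (CrossSideAt-ends b a ℓ ℓ-side)
    single : ∀ x y → x < y → Above b a x → Above a b y → ⊥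
    single = single-crossing k<ℓ a>b b>a
    open CrossingArcs a b L.wf-a L.wf-b k<ℓ a>b b>a

lemma3p11 : (n : ℕ) → 1 ≤ n → (T T' : ArcSet) → IsWigglyPT n T → IsWigglyPT n T'
    → (α α' : Arc) → T α → T' α' → α ≢ α'
    → (∀ γ → (T γ × γ ≢ α) ⇔ (T' γ × γ ≢ α'))
    → ((NonPointed α α' → j α ≡ i α'
         → (T (β₁ α α') × T' (β₁ α α')) × (T (β₁' α α') × T' (β₁' α α'))
           × ((g n α ⊕ g n α') ≈[ n ] half (g n (β₁ α α') ⊕ g n (β₁' α α'))))
      × (Crossing α α' → CrossesNWSE n α α'
         → (T (β₂ α α') × T' (β₂ α α')) × (T (β₂' α α') × T' (β₂' α α'))
           × ((g n α ⊕ g n α') ≈[ n ] (g n (β₂ α α') ⊕ g n (β₂' α α')))))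
lemma3p11 n _ T T' PT PT' α α' Tα T'α' _ same = (λ _ → non-pointed-flip) , (λ _ → crossing-flip)
  where open Flip n T T' PT PT' α α' Tα T'α' same
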